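{- For each $n$, let $P$ be a uniformly random Motzkin path of length $n$. Let ${\tt UNP}(P)$ be the number of horizontal steps of $P$ at height $0$ and ${\tt DEG}(P)$ the number of up-steps of $P$ starting at height $0$. Then for every $i,j\ge0$ the limit $\pi_{i,j}=\lim_{n\to\infty}\mathbb{P}({\tt UNP}(P)=i,\ {\tt DEG}(P)=j)$ exists, and the limiting probability generating function is \[ M_p(u,v)=\sum_{i,j\ge0}\pi_{i,j}u^iv^j=\frac{v}{(u+v-3)^2}. \]
   Context: A Motzkin path of length $n$ is a lattice path from $(0,0)$ to $(n,0)$ with steps $(1,1)$ (up), $(1,-1)$ (down) and $(1,0)$ (horizontal) that never goes below the $x$-axis. Equivalently, it is a dot-bracket string (a secondary structure): a word over $\{(,),.\}$ of length $n$ whose parentheses are balanced; then ${\tt DEG}$ is the number of base pairs (matched parenthesis pairs) not enclosed by any other pair and ${\tt UNP}$ is the number of dots not enclosed by any pair. -}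

module Defs where

open import Data.Nat as ℕ using (ℕ; zero; suc; _∸_; _≡ᵇ_)
open import Data.Bool using (Bool; true; false; _∧_)
open import Data.List using (List; []; _∷_; map; concatMap; length; filterᵇ)
open import Data.Integer using (+_)
open import Data.Rational using (ℚ; 0ℚ; 1ℚ; _/_; _+_; _*_; -_)
import Data.Rational as Q

data Step : Set where
  U D H : Step

words : ℕ → List (List Step)
words zero    = [] ∷ []
words (suc n) = concatMap (λ w → (U ∷ w) ∷ (D ∷ w) ∷ (H ∷ w) ∷ []) (words n)

validFrom : ℕ → List Step → Bool
validFrom zero    []      = true
validFrom (suc _) []      = false
validFrom h       (U ∷ w) = validFrom (suc h) w
validFrom zero    (D ∷ w) = false
validFrom (suc h) (D ∷ w) = validFrom h w
validFrom h       (H ∷ w) = validFrom h w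

isMotzkin : List Step → Bool
isMotzkin = validFrom 0

motzkin : ℕ → List (List Step)
motzkin n = filterᵇ isMotzkin (words n)

unpFrom : ℕ → List Step → ℕ
unpFrom h       []      = 0
unpFrom h       (U ∷ w) = unpFrom (suc h) w
unpFrom h       (D ∷ w) = unpFrom (h ∸ 1) w
unpFrom zero    (H ∷ w) = suc (unpFrom zero w)
unpFrom (suc h) (H ∷ w) = unpFrom (suc h) w

degFrom : ℕ → List Step → ℕ
degFrom h       []      = 0
degFrom zero    (U ∷ w) = suc (degFrom 1 w)
degFrom (suc h) (U ∷ w) = degFrom (suc (suc h)) w
degFrom h       (D ∷ w) = degFrom (h ∸ 1) w
degFrom h       (H ∷ w) = degFrom h w

UNP DEG : List Step → ℕ
UNP = unpFrom 0
DEG = degFrom 0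

count : ℕ → ℕ → ℕ → ℕ
count n i j = length (filterᵇ (λ w → (UNP w ≡ᵇ i) ∧ (DEG w ≡ᵇ j)) (motzkin n))

-- a / b as a rational (b = 0 never occurs below: there is always ≥ 1 Motzkin path)
ratio : ℕ → ℕ → ℚ
ratio a zero    = 0ℚ
ratio a (suc b) = (+ a) / suc b

prob : ℕ → ℕ → ℕ → ℚ
prob n i j = ratio (count n i j) (length (motzkin n))

ConvergesTo : (ℕ → ℚ) → ℚ → Set
ConvergesTo a L = ∀ (ε : ℚ) → 0ℚ Q.< ε →
  Data.Product.Σ ℕ (λ N → ∀ n → N ℕ.≤ n → Q.∣ a n Q.- L ∣ Q.< ε)
  where import Data.Product

-- Formal power series in two variables u, v: coefficient of u^i v^j.
Series : Set
Series = ℕ → ℕ → ℚ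

sumTo : ℕ → (ℕ → ℚ) → ℚ
sumTo zero    f = f 0
sumTo (suc n) f = sumTo n f + f (suc n)

_⊛_ : Series → Series → Series
(f ⊛ g) i j = sumTo i (λ a → sumTo j (λ b → f a b * g (i ∸ a) (j ∸ b)))

mono : ℚ → ℕ → ℕ → Series
mono c a b i j with i ≡ᵇ a | j ≡ᵇ b
... | true | true = c
... | _    | _    = 0ℚ

_⊕_ : Series → Series → Series
(f ⊕ g) i j = f i j + g i j

uS vS : Series
uS = mono 1ℚ 1 0
vS = mono 1ℚ 0 1

uv3 : Series
uv3 = uS ⊕ (vS ⊕ mono (- ((+ 3) / 1)) 0 0)

{-# OPTIONS --safe #-}

-- Cut a Motzkin path at its visits to height 0: it becomes a sequence of flat steps H and arches U·M·D with M a
-- Motzkin path. With UNP = i and DEG = j + 1 the i flat steps and j + 1 arches interleave in C(i+j+1, i) ways,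
-- and the j + 1 inner paths M, glued together by j down-steps, form a path from height j down to 0. Hence
-- #{UNP = i, DEG = j + 1} = C(i+j+1, i) · G_j(n − i − j − 2), where G_h(m) counts the paths of length m from
-- height h to 0, while DEG = 0 forces the path Hⁿ.
-- The reflection principle and the ballot theorem for unrestricted walks give the Motzkin recurrence
-- (n+4) M_{n+2} = (2n+5) M_{n+1} + 3(n+1) M_n, which traps M_n / M_{n+1} in [1/3, 1/3 + 1/(n+1)]. So
-- M_m / M_{m+s} → 3^{−s}, and peeling off first steps, G_h(m) / M_{m+s} → (h+1) / 3^s. This gives
-- π_{i,j} = C(i+j, i) · j / 3^{i+j+1}, and (u + v − 3)² Σ π_{i,j} uⁱvʲ = v reduces, coefficientwise, to
-- Pascal's rule for C(i+j, i).
module Submission where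

open import Defs
open import Data.Product using (Σ; _×_; _,_)
open import Data.Nat using (ℕ)
open import Data.Rational using (ℚ)
open import Relation.Binary.PropositionalEquality using (_≡_)


module Paths where

  open import Data.Bool using (Bool; true; false; _∧_; if_then_else_)
  open import Data.Bool.Properties using (∧-zeroʳ)
  open import Data.List using (List; []; _∷_; length; filterᵇ; concatMap)
  open import Data.Nat using (ℕ; zero; suc; _+_; _*_; _≡ᵇ_)
  open import Data.Nat.Properties using (+-suc; +-comm; +-identityʳ; *-identityˡ; *-zeroʳ; *-distribʳ-+)
  open import Data.Nat.Combinatorics using (_C_; nCk+nC[k+1]≡[n+1]C[k+1]; nCn≡1)
  open import Data.Nat.Tactic.RingSolver using (solve-∀)
  open import Relation.Binary.PropositionalEquality
  open ≡-Reasoning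

  indicator : Bool → ℕ
  indicator b = if b then 1 else 0

  countᵇ : {A : Set} → (A → Bool) → List A → ℕ
  countᵇ p []       = 0
  countᵇ p (x ∷ xs) = indicator (p x) + countᵇ p xs

  length-filterᵇ : ∀ {A : Set} (p : A → Bool) xs → length (filterᵇ p xs) ≡ countᵇ p xs
  length-filterᵇ p []       = refl
  length-filterᵇ p (x ∷ xs) with p x
  ... | true  = cong suc (length-filterᵇ p xs)
  ... | false = length-filterᵇ p xs

  length-filterᵇ-filterᵇ : ∀ {A : Set} (p q : A → Bool) xs →
    length (filterᵇ q (filterᵇ p xs)) ≡ countᵇ (λ x → p x ∧ q x) xs
  length-filterᵇ-filterᵇ p q []       = refl
  length-filterᵇ-filterᵇ p q (x ∷ xs) with p x
  ... | false = length-filterᵇ-filterᵇ p q xs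
  ... | true with q x
  ...   | true  = cong suc (length-filterᵇ-filterᵇ p q xs)
  ...   | false = length-filterᵇ-filterᵇ p q xs

  countᵇ-false : ∀ {A : Set} {p : A → Bool} xs → (∀ x → p x ≡ false) → countᵇ p xs ≡ 0
  countᵇ-false []       p≗false = refl
  countᵇ-false (x ∷ xs) p≗false rewrite p≗false x = countᵇ-false xs p≗false

  countᵇ-words-suc : ∀ p n → countᵇ p (words (suc n)) ≡
    countᵇ (λ w → p (U ∷ w)) (words n) + countᵇ (λ w → p (D ∷ w)) (words n) + countᵇ (λ w → p (H ∷ w)) (words n)
  countᵇ-words-suc p n = extensions (words n)
    where
    extensions : ∀ ws → countᵇ p (concatMap (λ w → (U ∷ w) ∷ (D ∷ w) ∷ (H ∷ w) ∷ []) ws) ≡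
      countᵇ (λ w → p (U ∷ w)) ws + countᵇ (λ w → p (D ∷ w)) ws + countᵇ (λ w → p (H ∷ w)) ws
    extensions []       = refl
    extensions (w ∷ ws) = trans (cong (λ t → iU + (iD + (iH + t))) (extensions ws)) (regroup iU iD iH _ _ _)
      where
      iU = indicator (p (U ∷ w))
      iD = indicator (p (D ∷ w))
      iH = indicator (p (H ∷ w))
      regroup : ∀ a b c x y z → a + (b + (c + (x + y + z))) ≡ (a + x) + (b + y) + (c + z)
      regroup = solve-∀

  countᵇ-words-suc-noD : ∀ p n → (∀ w → p (D ∷ w) ≡ false) →
    countᵇ p (words (suc n)) ≡ countᵇ (λ w → p (U ∷ w)) (words n) + countᵇ (λ w → p (H ∷ w)) (words n)
  countᵇ-words-suc-noD p n noD = begin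
      countᵇ p (words (suc n))
    ≡⟨ countᵇ-words-suc p n ⟩
      #U + countᵇ (λ w → p (D ∷ w)) (words n) + #H
    ≡⟨ cong (λ t → #U + t + #H) (countᵇ-false (words n) noD) ⟩
      #U + 0 + #H
    ≡⟨ cong (_+ #H) (+-identityʳ #U) ⟩
      #U + #H ∎
    where
    #U = countᵇ (λ w → p (U ∷ w)) (words n)
    #H = countᵇ (λ w → p (H ∷ w)) (words n)

  paths : ℕ → ℕ → ℕ
  paths h n = countᵇ (validFrom h) (words n)

  pathsWith : ℕ → ℕ → ℕ → ℕ → ℕ
  pathsWith h i j n = countᵇ (λ w → validFrom h w ∧ ((unpFrom h w ≡ᵇ i) ∧ (degFrom h w ≡ᵇ j))) (words n)

  paths-suc-zero : ∀ n → paths 0 (suc n) ≡ paths 1 n + paths 0 n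
  paths-suc-zero n = countᵇ-words-suc-noD (validFrom 0) n (λ _ → refl)

  paths-suc-suc : ∀ h n → paths (suc h) (suc n) ≡ paths (suc (suc h)) n + paths h n + paths (suc h) n
  paths-suc-suc h = countᵇ-words-suc (validFrom (suc h))

  pathsWith-suc-suc : ∀ h i j n →
    pathsWith (suc h) i j (suc n) ≡ pathsWith (suc (suc h)) i j n + pathsWith h i j n + pathsWith (suc h) i j n
  pathsWith-suc-suc h i j = countᵇ-words-suc _

  pathsWith-suc-arch : ∀ i j n → pathsWith 0 (suc i) (suc j) (suc n) ≡ pathsWith 1 (suc i) j n + pathsWith 0 i (suc j) n
  pathsWith-suc-arch i j n = countᵇ-words-suc-noD _ n (λ _ → refl)

  pathsWith-suc-first-arch : ∀ j n → pathsWith 0 0 (suc j) (suc n) ≡ pathsWith 1 0 j n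
  pathsWith-suc-first-arch j n = begin
      pathsWith 0 0 (suc j) (suc n)
    ≡⟨ countᵇ-words-suc-noD _ n (λ _ → refl) ⟩
      pathsWith 1 0 j n + countᵇ (λ w → validFrom 0 w ∧ false) (words n)
    ≡⟨ cong (pathsWith 1 0 j n +_) (countᵇ-false (words n) (λ w → ∧-zeroʳ (validFrom 0 w))) ⟩
      pathsWith 1 0 j n + 0
    ≡⟨ +-identityʳ _ ⟩
      pathsWith 1 0 j n ∎

  pathsWith-flat : ∀ i n → pathsWith 0 i 0 n ≡ indicator (n ≡ᵇ i)
  pathsWith-flat zero    zero    = refl
  pathsWith-flat (suc i) zero    = refl
  pathsWith-flat i       (suc n) = begin
      pathsWith 0 i 0 (suc n)
    ≡⟨ countᵇ-words-suc-noD _ n (λ _ → refl) ⟩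
      countᵇ (λ w → validFrom 1 w ∧ ((unpFrom 1 w ≡ᵇ i) ∧ false)) (words n) + #H i
    ≡⟨ cong (_+ #H i) (countᵇ-false (words n) (λ w → trans (cong (validFrom 1 w ∧_) (∧-zeroʳ (unpFrom 1 w ≡ᵇ i)))
                                                             (∧-zeroʳ (validFrom 1 w)))) ⟩
      #H i
    ≡⟨ flat i ⟩
      indicator (suc n ≡ᵇ i) ∎
    where
    #H : ℕ → ℕ
    #H i = countᵇ (λ w → validFrom 0 w ∧ ((suc (unpFrom 0 w) ≡ᵇ i) ∧ (degFrom 0 w ≡ᵇ 0))) (words n)
    flat : ∀ i → #H i ≡ indicator (suc n ≡ᵇ i)
    flat zero    = countᵇ-false (words n) (λ w → ∧-zeroʳ (validFrom 0 w))
    flat (suc i) = pathsWith-flat i n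

  delay : ℕ → (ℕ → ℕ) → ℕ → ℕ
  delay zero    f n       = f n
  delay (suc s) f zero    = 0
  delay (suc s) f (suc n) = delay s f n

  delay-+ : ∀ s f n → delay s f (s + n) ≡ f n
  delay-+ zero    f n = refl
  delay-+ (suc s) f n = delay-+ s f n

  delay-paths-suc-suc : ∀ h s n →
    delay s (paths (suc h)) (suc n) ≡ delay s (paths (suc (suc h))) n + delay s (paths h) n + delay s (paths (suc h)) n
  delay-paths-suc-suc h zero          n       = paths-suc-suc h n
  delay-paths-suc-suc h (suc zero)    zero    = refl
  delay-paths-suc-suc h (suc (suc s)) zero    = refl
  delay-paths-suc-suc h (suc s)       (suc n) = delay-paths-suc-suc h s n

  delay-paths-suc-zero : ∀ s n →
    delay s (paths 0) (suc n) ≡ delay s (paths 1) n + indicator (suc n ≡ᵇ s) + delay s (paths 0) n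
  delay-paths-suc-zero zero          n       = trans (paths-suc-zero n) (cong (_+ paths 0 n) (sym (+-identityʳ (paths 1 n))))
  delay-paths-suc-zero (suc zero)    zero    = refl
  delay-paths-suc-zero (suc (suc s)) zero    = refl
  delay-paths-suc-zero (suc s)       (suc n) = delay-paths-suc-zero s n

  private
    factor₃ : ∀ c {x y z a b d} → x ≡ c * a → y ≡ c * b → z ≡ c * d → x + y + z ≡ c * (a + b + d)
    factor₃ c {a = a} {b} {d} refl refl refl = distrib c a b d
      where
      distrib : ∀ c a b d → c * a + c * b + c * d ≡ c * (a + b + d)
      distrib = solve-∀

  -- From height h + 1 a path first descends to 0 and then interleaves i flat steps with j arches; the descent
  -- and the interiors of the arches glue to a path from height h + j to 0.
  mutual
    pathsWith-above : ∀ h i j n → pathsWith (suc h) i j n ≡ ((j + i) C i) * delay (suc (j + i)) (paths (h + j)) n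
    pathsWith-above h i j zero = sym (*-zeroʳ ((j + i) C i))
    pathsWith-above (suc h) i j (suc n) =
      trans (pathsWith-suc-suc (suc h) i j n)
        (trans (factor₃ ((j + i) C i) (pathsWith-above (suc (suc h)) i j n) (pathsWith-above h i j n)
                                      (pathsWith-above (suc h) i j n))
               (cong (((j + i) C i) *_) (sym (delay-paths-suc-suc (h + j) (suc (j + i)) n))))
    pathsWith-above zero i (suc j) (suc n) =
      trans (pathsWith-suc-suc 0 i (suc j) n)
        (trans (factor₃ (suc (j + i) C i) (pathsWith-above 1 i (suc j) n) (pathsWith-arches i j n)
                                          (pathsWith-above 0 i (suc j) n))
               (cong ((suc (j + i) C i) *_) (sym (delay-paths-suc-suc j (suc (suc (j + i))) n))))
    pathsWith-above zero i zero (suc n) =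
      trans (pathsWith-suc-suc 0 i 0 n)
        (trans (factor₃ (i C i) (pathsWith-above 1 i 0 n) flat (pathsWith-above 0 i 0 n))
               (cong ((i C i) *_) (sym (delay-paths-suc-zero (suc i) n))))
      where
      flat : pathsWith 0 i 0 n ≡ (i C i) * indicator (n ≡ᵇ i)
      flat = trans (pathsWith-flat i n) (sym (trans (cong (_* indicator (n ≡ᵇ i)) (nCn≡1 i)) (*-identityˡ _)))

    pathsWith-arches : ∀ i j n → pathsWith 0 i (suc j) n ≡ (suc (j + i) C i) * delay (suc (suc (j + i))) (paths j) n
    pathsWith-arches zero    j zero    = refl
    pathsWith-arches (suc i) j zero    = sym (*-zeroʳ (suc (j + suc i) C suc i))
    pathsWith-arches zero    j (suc n) = trans (pathsWith-suc-first-arch j n) (pathsWith-above 0 0 j n)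
    pathsWith-arches (suc i) j (suc n) = begin
        pathsWith 0 (suc i) (suc j) (suc n)
      ≡⟨ pathsWith-suc-arch i j n ⟩
        pathsWith 1 (suc i) j n + pathsWith 0 i (suc j) n
      ≡⟨ cong₂ _+_ (pathsWith-above 0 (suc i) j n) (pathsWith-arches i j n) ⟩
        ((j + suc i) C suc i) * delay (suc (j + suc i)) (paths j) n + (suc (j + i) C i) * d
      ≡⟨ cong (λ m → (m C suc i) * delay (suc m) (paths j) n + (suc (j + i) C i) * d) (+-suc j i) ⟩
        (suc (j + i) C suc i) * d + (suc (j + i) C i) * d
      ≡⟨ sym (*-distribʳ-+ d (suc (j + i) C suc i) (suc (j + i) C i)) ⟩
        (suc (j + i) C suc i + suc (j + i) C i) * d
      ≡⟨ cong (_* d) (trans (+-comm (suc (j + i) C suc i) _) (nCk+nC[k+1]≡[n+1]C[k+1] (suc (j + i)) i)) ⟩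
        (suc (suc (j + i)) C suc i) * d
      ≡⟨ cong (λ m → (suc m C suc i) * delay (suc m) (paths j) n) (sym (+-suc j i)) ⟩
        (suc (j + suc i) C suc i) * delay (suc (suc (j + suc i))) (paths j) (suc n) ∎
      where
      d = delay (suc (suc (j + i))) (paths j) n

  count≡pathsWith : ∀ n i j → count n i j ≡ pathsWith 0 i j n
  count≡pathsWith n i j = length-filterᵇ-filterᵇ isMotzkin (λ w → (UNP w ≡ᵇ i) ∧ (DEG w ≡ᵇ j)) (words n)

  length-motzkin : ∀ n → length (motzkin n) ≡ paths 0 n
  length-motzkin n = length-filterᵇ isMotzkin (words n)

module MotzkinNumbers where

  open Paths
  open import Data.Nat using (ℕ; zero; suc; _+_; _*_; _≤_; z≤n; s≤s)
  open import Data.Nat.Properties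
  open import Data.Nat.Tactic.RingSolver using (solve-∀)
  open import Data.Product using (_×_; _,_)
  open import Relation.Binary.PropositionalEquality
  open ≤-Reasoning

  -- walks n k counts the words of length n ending at height k, and also those ending at height −k:
  -- the clause for height 0 uses this symmetry.
  walks : ℕ → ℕ → ℕ
  walks zero    zero    = 1
  walks zero    (suc k) = 0
  walks (suc n) zero    = walks n 1 + walks n 0 + walks n 1
  walks (suc n) (suc k) = walks n k + walks n (suc k) + walks n (suc (suc k))

  -- The reflection principle: a walk from h to 0 that dips below 0 is reflected at −1 into a walk from h to −2.
  paths+walks≡walks : ∀ h n → paths h n + walks n (2 + h) ≡ walks n h
  paths+walks≡walks zero    zero    = refl
  paths+walks≡walks (suc h) zero    = refl
  paths+walks≡walks zero    (suc n) = begin-equality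
      paths 0 (suc n) + walks (suc n) 2
    ≡⟨ cong (_+ walks (suc n) 2) (paths-suc-zero n) ⟩
      paths 1 n + paths 0 n + (walks n 1 + walks n 2 + walks n 3)
    ≡⟨ regroup (paths 0 n) (paths 1 n) (walks n 1) (walks n 2) (walks n 3) ⟩
      walks n 1 + (paths 0 n + walks n 2) + (paths 1 n + walks n 3)
    ≡⟨ cong₂ (λ x y → walks n 1 + x + y) (paths+walks≡walks 0 n) (paths+walks≡walks 1 n) ⟩
      walks (suc n) 0 ∎
    where
    regroup : ∀ p₀ p₁ w₁ w₂ w₃ → p₁ + p₀ + (w₁ + w₂ + w₃) ≡ w₁ + (p₀ + w₂) + (p₁ + w₃)
    regroup = solve-∀
  paths+walks≡walks (suc h) (suc n) = begin-equality
      paths (suc h) (suc n) + walks (suc n) (3 + h)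
    ≡⟨ cong (_+ walks (suc n) (3 + h)) (paths-suc-suc h n) ⟩
      paths (2 + h) n + paths h n + paths (1 + h) n + (walks n (2 + h) + walks n (3 + h) + walks n (4 + h))
    ≡⟨ regroup (paths h n) (paths (1 + h) n) (paths (2 + h) n) (walks n (2 + h)) (walks n (3 + h)) (walks n (4 + h)) ⟩
      (paths h n + walks n (2 + h)) + (paths (1 + h) n + walks n (3 + h)) + (paths (2 + h) n + walks n (4 + h))
    ≡⟨ cong₂ _+_ (cong₂ _+_ (paths+walks≡walks h n) (paths+walks≡walks (1 + h) n)) (paths+walks≡walks (2 + h) n) ⟩
      walks (suc n) (suc h) ∎
    where
    regroup : ∀ p₀ p₁ p₂ w₂ w₃ w₄ → p₂ + p₀ + p₁ + (w₂ + w₃ + w₄) ≡ (p₀ + w₂) + (p₁ + w₃) + (p₂ + w₄)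
    regroup = solve-∀

  private
    ballot-step : ∀ n k a b c d e →
      k * (a + b + c) + (1 + n) * c ≡ (1 + n) * a →
      (1 + k) * (b + c + d) + (1 + n) * d ≡ (1 + n) * b →
      (2 + k) * (c + d + e) + (1 + n) * e ≡ (1 + n) * c →
      (1 + k) * ((a + b + c) + (b + c + d) + (c + d + e)) + (2 + n) * (c + d + e) ≡ (2 + n) * (a + b + c)
    ballot-step n k a b c d e ha hb hc = +-cancelʳ-≡ _ _ _ (begin-equality
        (1 + k) * ((a + b + c) + (b + c + d) + (c + d + e)) + (2 + n) * (c + d + e) + (1 + n) * (a + b + c)
      ≡⟨ expand n k a b c d e ⟩
        (2 + n) * (a + b + c)
          + ((k * (a + b + c) + (1 + n) * c) + ((1 + k) * (b + c + d) + (1 + n) * d) + ((2 + k) * (c + d + e) + (1 + n) * e))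
      ≡⟨ cong (λ t → (2 + n) * (a + b + c) + t) (cong₂ _+_ (cong₂ _+_ ha hb) hc) ⟩
        (2 + n) * (a + b + c) + ((1 + n) * a + (1 + n) * b + (1 + n) * c)
      ≡⟨ cong ((2 + n) * (a + b + c) +_) (sym (distrib n a b c)) ⟩
        (2 + n) * (a + b + c) + (1 + n) * (a + b + c) ∎)
      where
      expand : ∀ n k a b c d e →
        (1 + k) * ((a + b + c) + (b + c + d) + (c + d + e)) + (2 + n) * (c + d + e) + (1 + n) * (a + b + c)
        ≡ (2 + n) * (a + b + c)
          + ((k * (a + b + c) + (1 + n) * c) + ((1 + k) * (b + c + d) + (1 + n) * d) + ((2 + k) * (c + d + e) + (1 + n) * e))
      expand = solve-∀
      distrib : ∀ n a b c → (1 + n) * (a + b + c) ≡ (1 + n) * a + (1 + n) * b + (1 + n) * c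
      distrib = solve-∀

  -- Combined with the reflection principle this is the ballot theorem (1 + k) · walks (1 + n) (1 + k) ≡ (1 + n) · paths k n.
  walks-ballot : ∀ n k → (1 + k) * walks (suc n) (suc k) + (1 + n) * walks n (2 + k) ≡ (1 + n) * walks n k
  walks-ballot zero    zero    = refl
  walks-ballot zero    (suc k) = cong (_+ 0) (*-zeroʳ k)
  walks-ballot (suc n) zero    =
    ballot-step n 0 (walks n 1) (walks n 0) (walks n 1) (walks n 2) (walks n 3) refl (walks-ballot n 0) (walks-ballot n 1)
  walks-ballot (suc n) (suc k) =
    ballot-step n (suc k) (walks n k) (walks n (1 + k)) (walks n (2 + k)) (walks n (3 + k)) (walks n (4 + k))
         (walks-ballot n k) (walks-ballot n (1 + k)) (walks-ballot n (2 + k))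

  walks-suc-one : ∀ n → walks (suc n) 1 ≡ (1 + n) * paths 0 n
  walks-suc-one n = +-cancelʳ-≡ ((1 + n) * walks n 2) _ _ (begin-equality
      walks (suc n) 1 + (1 + n) * walks n 2
    ≡⟨ cong (_+ (1 + n) * walks n 2) (sym (*-identityˡ (walks (suc n) 1))) ⟩
      1 * walks (suc n) 1 + (1 + n) * walks n 2
    ≡⟨ walks-ballot n 0 ⟩
      (1 + n) * walks n 0
    ≡⟨ cong ((1 + n) *_) (sym (paths+walks≡walks 0 n)) ⟩
      (1 + n) * (paths 0 n + walks n 2)
    ≡⟨ *-distribˡ-+ (1 + n) (paths 0 n) (walks n 2) ⟩
      (1 + n) * paths 0 n + (1 + n) * walks n 2 ∎)

  motzkin-walks : ∀ n → (2 + n) * paths 0 n ≡ walks n 0 + walks n 1 + walks n 0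
  motzkin-walks n = +-cancelʳ-≡ (walks n 2) _ _ (begin-equality
      (2 + n) * paths 0 n + walks n 2
    ≡⟨ split n (paths 0 n) (walks n 2) ⟩
      (1 + n) * paths 0 n + (paths 0 n + walks n 2)
    ≡⟨ cong₂ _+_ (sym (walks-suc-one n)) (paths+walks≡walks 0 n) ⟩
      walks n 0 + walks n 1 + walks n 2 + walks n 0
    ≡⟨ regroup (walks n 0) (walks n 1) (walks n 2) ⟩
      walks n 0 + walks n 1 + walks n 0 + walks n 2 ∎)
    where
    split : ∀ n m w → (2 + n) * m + w ≡ (1 + n) * m + (m + w)
    split = solve-∀
    regroup : ∀ w₀ w₁ w₂ → w₀ + w₁ + w₂ + w₀ ≡ w₀ + w₁ + w₀ + w₂
    regroup = solve-∀

  motzkin-recurrence : ∀ n → (4 + n) * paths 0 (2 + n) ≡ (5 + 2 * n) * paths 0 (1 + n) + 3 * ((1 + n) * paths 0 n)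
  motzkin-recurrence n = begin-equality
      (4 + n) * paths 0 (2 + n)
    ≡⟨ motzkin-walks (2 + n) ⟩
      w₀⁺ + walks (2 + n) 1 + w₀⁺
    ≡⟨ cong (λ t → w₀⁺ + t + w₀⁺) (walks-suc-one (1 + n)) ⟩
      w₀⁺ + (2 + n) * paths 0 (1 + n) + w₀⁺
    ≡⟨ regroup n w₀ w₁ (paths 0 (1 + n)) ⟩
      3 * w₁ + (w₀ + w₁ + w₀) + (2 + n) * paths 0 (1 + n)
    ≡⟨ cong₂ (λ x y → 3 * x + y + (2 + n) * paths 0 (1 + n)) (walks-suc-one n) (sym (motzkin-walks (1 + n))) ⟩
      3 * ((1 + n) * paths 0 n) + (3 + n) * paths 0 (1 + n) + (2 + n) * paths 0 (1 + n)
    ≡⟨ collect n (paths 0 n) (paths 0 (1 + n)) ⟩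
      (5 + 2 * n) * paths 0 (1 + n) + 3 * ((1 + n) * paths 0 n) ∎
    where
    w₀ = walks (1 + n) 0
    w₁ = walks (1 + n) 1
    w₀⁺ = w₁ + w₀ + w₁
    regroup : ∀ n w₀ w₁ m → (w₁ + w₀ + w₁) + (2 + n) * m + (w₁ + w₀ + w₁) ≡ 3 * w₁ + (w₀ + w₁ + w₀) + (2 + n) * m
    regroup = solve-∀
    collect : ∀ n m₀ m₁ → 3 * ((1 + n) * m₀) + (3 + n) * m₁ + (2 + n) * m₁ ≡ (5 + 2 * n) * m₁ + 3 * ((1 + n) * m₀)
    collect = solve-∀

  motzkin-ratio-bounds : ∀ n → 3 * ((1 + n) * paths 0 n) ≤ (3 + n) * paths 0 (1 + n) × paths 0 (1 + n) ≤ 3 * paths 0 n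
  motzkin-ratio-bounds zero    = ≤-refl , s≤s z≤n
  motzkin-ratio-bounds (suc n) with motzkin-ratio-bounds n
  ... | lower , upper = lower′ , upper′
    where
    m₀ = paths 0 n
    m₁ = paths 0 (1 + n)
    m₂ = paths 0 (2 + n)
    upper′ : m₂ ≤ 3 * m₁
    upper′ = *-cancelˡ-≤ (4 + n) (begin
        (4 + n) * m₂                              ≡⟨ motzkin-recurrence n ⟩
        (5 + 2 * n) * m₁ + 3 * ((1 + n) * m₀)     ≤⟨ +-monoʳ-≤ ((5 + 2 * n) * m₁) lower ⟩
        (5 + 2 * n) * m₁ + (3 + n) * m₁           ≤⟨ m≤m+n _ (4 * m₁) ⟩
        (5 + 2 * n) * m₁ + (3 + n) * m₁ + 4 * m₁  ≡⟨ collect n m₁ ⟩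
        (4 + n) * (3 * m₁)                        ∎)
      where
      collect : ∀ n m → (5 + 2 * n) * m + (3 + n) * m + 4 * m ≡ (4 + n) * (3 * m)
      collect = solve-∀
    lower′ : 3 * ((2 + n) * m₁) ≤ (4 + n) * m₂
    lower′ = begin
        3 * ((2 + n) * m₁)                        ≡⟨ split n m₁ ⟩
        (5 + 2 * n) * m₁ + (1 + n) * m₁           ≤⟨ +-monoʳ-≤ ((5 + 2 * n) * m₁) (*-monoʳ-≤ (1 + n) upper) ⟩
        (5 + 2 * n) * m₁ + (1 + n) * (3 * m₀)     ≡⟨ cong ((5 + 2 * n) * m₁ +_) (swap n m₀) ⟩
        (5 + 2 * n) * m₁ + 3 * ((1 + n) * m₀)     ≡⟨ motzkin-recurrence n ⟨
        (4 + n) * m₂                              ∎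
      where
      split : ∀ n m → 3 * ((2 + n) * m) ≡ (5 + 2 * n) * m + (1 + n) * m
      split = solve-∀
      swap : ∀ n m → (1 + n) * (3 * m) ≡ 3 * ((1 + n) * m)
      swap = solve-∀

  motzkin-mono : ∀ n → paths 0 n ≤ paths 0 (suc n)
  motzkin-mono n = ≤-trans (m≤n+m (paths 0 n) (paths 1 n)) (≤-reflexive (sym (paths-suc-zero n)))

  motzkin-positive : ∀ n → 1 ≤ paths 0 n
  motzkin-positive zero    = ≤-refl
  motzkin-positive (suc n) = ≤-trans (motzkin-positive n) (motzkin-mono n)

module Fractions where

  open import Data.Nat as ℕ using (ℕ; suc; NonZero)
  import Data.Nat.Properties as ℕₚ
  open import Data.Nat.Tactic.RingSolver using (solve-∀)
  open import Data.Integer as ℤ using (+_)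
  import Data.Integer.Properties as ℤₚ
  open import Data.Rational as ℚ using (ℚ; 0ℚ; _+_; _*_; _≤_; _<_)
  import Data.Rational.Properties as ℚₚ
  open import Data.Rational.Unnormalised as ℚᵘ using (mkℚᵘ; _≃_)
  import Data.Rational.Unnormalised.Properties as ℚᵘₚ
  open import Relation.Binary.PropositionalEquality

  private
    toℚᵘ-ratio : ∀ x b → ℚ.toℚᵘ (ratio x (suc b)) ≃ mkℚᵘ (+ x) b
    toℚᵘ-ratio x b = ℚₚ.toℚᵘ-fromℚᵘ (mkℚᵘ (+ x) b)

    +-* : ∀ x y → + x ℤ.* + y ≡ + (x ℕ.* y)
    +-* x y = sym (ℤₚ.pos-* x y)

  ratio-cong : ∀ x b y d .{{b≢0 : NonZero b}} .{{d≢0 : NonZero d}} → x ℕ.* d ≡ y ℕ.* b → ratio x b ≡ ratio y d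
  ratio-cong x (suc b) y (suc d) eq = ℚₚ.toℚᵘ-injective
    (ℚᵘₚ.≃-trans (toℚᵘ-ratio x b) (ℚᵘₚ.≃-trans (ℚᵘ.*≡* cross) (ℚᵘₚ.≃-sym (toℚᵘ-ratio y d))))
    where
    cross : + x ℤ.* + suc d ≡ + y ℤ.* + suc b
    cross = trans (+-* x (suc d)) (trans (cong +_ eq) (sym (+-* y (suc b))))

  ratio-mono-≤ : ∀ x b y d .{{b≢0 : NonZero b}} .{{d≢0 : NonZero d}} → x ℕ.* d ℕ.≤ y ℕ.* b → ratio x b ≤ ratio y d
  ratio-mono-≤ x (suc b) y (suc d) le = ℚₚ.toℚᵘ-cancel-≤
    (ℚᵘₚ.≤-respˡ-≃ (ℚᵘₚ.≃-sym (toℚᵘ-ratio x b)) (ℚᵘₚ.≤-respʳ-≃ (ℚᵘₚ.≃-sym (toℚᵘ-ratio y d)) (ℚᵘ.*≤* cross)))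
    where
    cross : + x ℤ.* + suc d ℤ.≤ + y ℤ.* + suc b
    cross = subst₂ ℤ._≤_ (sym (+-* x (suc d))) (sym (+-* y (suc b))) (ℤ.+≤+ le)

  ratio-mono-< : ∀ x b y d .{{b≢0 : NonZero b}} .{{d≢0 : NonZero d}} → x ℕ.* d ℕ.< y ℕ.* b → ratio x b < ratio y d
  ratio-mono-< x (suc b) y (suc d) lt = ℚₚ.toℚᵘ-cancel-<
    (ℚᵘₚ.<-respˡ-≃ (ℚᵘₚ.≃-sym (toℚᵘ-ratio x b)) (ℚᵘₚ.<-respʳ-≃ (ℚᵘₚ.≃-sym (toℚᵘ-ratio y d)) (ℚᵘ.*<* cross)))
    where
    cross : + x ℤ.* + suc d ℤ.< + y ℤ.* + suc b
    cross = subst₂ ℤ._<_ (sym (+-* x (suc d))) (sym (+-* y (suc b))) (ℤ.+<+ lt)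

  ratio-+ : ∀ x b y d .{{b≢0 : NonZero b}} .{{d≢0 : NonZero d}} →
    ratio x b + ratio y d ≡ ratio (x ℕ.* d ℕ.+ y ℕ.* b) (b ℕ.* d)
  ratio-+ x (suc b) y (suc d) = ℚₚ.toℚᵘ-injective
    (ℚᵘₚ.≃-trans (ℚₚ.toℚᵘ-homo-+ (ratio x (suc b)) (ratio y (suc d)))
    (ℚᵘₚ.≃-trans (ℚᵘₚ.+-cong (toℚᵘ-ratio x b) (toℚᵘ-ratio y d))
    (ℚᵘₚ.≃-trans (ℚᵘₚ.≃-reflexive sum) (ℚᵘₚ.≃-sym (toℚᵘ-ratio _ _)))))
    where
    sum : mkℚᵘ (+ x) b ℚᵘ.+ mkℚᵘ (+ y) d ≡ mkℚᵘ (+ (x ℕ.* suc d ℕ.+ y ℕ.* suc b)) (ℕ.pred (suc b ℕ.* suc d))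
    sum = cong (λ n → mkℚᵘ n (ℕ.pred (suc b ℕ.* suc d)))
      (trans (cong₂ ℤ._+_ (+-* x (suc d)) (+-* y (suc b))) (sym (ℤₚ.pos-+ (x ℕ.* suc d) (y ℕ.* suc b))))

  ratio-* : ∀ x b y d .{{b≢0 : NonZero b}} .{{d≢0 : NonZero d}} → ratio x b * ratio y d ≡ ratio (x ℕ.* y) (b ℕ.* d)
  ratio-* x (suc b) y (suc d) = ℚₚ.toℚᵘ-injective
    (ℚᵘₚ.≃-trans (ℚₚ.toℚᵘ-homo-* (ratio x (suc b)) (ratio y (suc d)))
    (ℚᵘₚ.≃-trans (ℚᵘₚ.*-cong (toℚᵘ-ratio x b) (toℚᵘ-ratio y d))
    (ℚᵘₚ.≃-trans (ℚᵘₚ.≃-reflexive (cong (λ n → mkℚᵘ n (ℕ.pred (suc b ℕ.* suc d))) (+-* x y)))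
                 (ℚᵘₚ.≃-sym (toℚᵘ-ratio _ _)))))

  ratio-zero : ∀ d .{{_ : NonZero d}} → ratio 0 d ≡ 0ℚ
  ratio-zero (suc d) = ℚₚ.0/n≡0 (suc d)

  ratio-nonNegative : ∀ x d .{{_ : NonZero d}} → 0ℚ ≤ ratio x d
  ratio-nonNegative x d = subst (_≤ ratio x d) (ratio-zero d) (ratio-mono-≤ 0 d x d ℕ.z≤n)

  ratio-+-same : ∀ x y d .{{_ : NonZero d}} → ratio x d + ratio y d ≡ ratio (x ℕ.+ y) d
  ratio-+-same x y d = trans (ratio-+ x d y d) (ratio-cong _ _ _ _ {{ℕₚ.m*n≢0 d d}} (cross x y d))
    where
    cross : ∀ x y d → (x ℕ.* d ℕ.+ y ℕ.* d) ℕ.* d ≡ (x ℕ.+ y) ℕ.* (d ℕ.* d)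
    cross = solve-∀

module Limits where

  open Fractions
  open import Data.Nat as ℕ using (ℕ; zero; suc; _⊔_; _∸_)
  import Data.Nat.Properties as ℕₚ
  open import Data.Integer as ℤ using (+_; +[1+_]; -[1+_])
  open import Data.Rational as ℚ using (ℚ; mkℚ; 0ℚ; 1ℚ; ½; ∣_∣; _+_; _*_; _-_; -_; _≤_; _<_)
  import Data.Rational.Properties as ℚₚ
  open import Data.Rational.Solver using (module +-*-Solver)
  open import Data.Empty using (⊥-elim)
  open import Data.Product using (_,_)
  open import Relation.Binary.PropositionalEquality
  open +-*-Solver

  private
    halves : ∀ ε → ε * ½ + ε * ½ ≡ ε
    halves = solve 1 (λ ε → ε :* con ½ :+ ε :* con ½ := ε) refl

    half-pos : ∀ {ε} → 0ℚ < ε → 0ℚ < ε * ½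
    half-pos {ε} ε>0 = subst (_< ε * ½) (ℚₚ.*-zeroˡ ½) (ℚₚ.*-monoˡ-<-pos ½ ε>0)

  -- A wrapper around ConvergesTo, whose arguments Agda cannot infer from its unfolded type.
  record _⟶_ (x : ℕ → ℚ) (L : ℚ) : Set where
    constructor converges
    field convergence : ConvergesTo x L

  open _⟶_ public

  convergesTo-const : ∀ c → (λ _ → c) ⟶ c
  convergesTo-const c = converges λ ε ε>0 → 0 , λ n _ → subst (_< ε) (sym (cong ∣_∣ (ℚₚ.+-inverseʳ c))) ε>0

  convergesTo-eventually : ∀ {x y L} N → (∀ n → N ℕ.≤ n → x n ≡ y n) → x ⟶ L → y ⟶ L
  convergesTo-eventually {L = L} N x≡y (converges x→L) = converges λ ε ε>0 →
    let M , close = x→L ε ε>0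
    in N ⊔ M , λ n n≥ →
      subst (λ t → ∣ t - L ∣ < ε) (x≡y n (ℕₚ.m⊔n≤o⇒m≤o N M n≥)) (close n (ℕₚ.m⊔n≤o⇒n≤o N M n≥))

  convergesTo-shift : ∀ {x L} k → x ⟶ L → (λ n → x (k ℕ.+ n)) ⟶ L
  convergesTo-shift k (converges x→L) = converges λ ε ε>0 →
    let N , close = x→L ε ε>0
    in N , λ n n≥N → close (k ℕ.+ n) (ℕₚ.≤-trans n≥N (ℕₚ.m≤n+m n k))

  convergesTo-delay : ∀ {x L} s → x ⟶ L → (λ n → x (n ∸ s)) ⟶ L
  convergesTo-delay s (converges x→L) = converges λ ε ε>0 →
    let N , close = x→L ε ε>0
    in N ℕ.+ s , λ n n≥ → close (n ∸ s) (subst (ℕ._≤ n ∸ s) (ℕₚ.m+n∸n≡m N s) (ℕₚ.∸-monoˡ-≤ s n≥))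

  convergesTo-+ : ∀ {x y X Y} → x ⟶ X → y ⟶ Y → (λ n → x n + y n) ⟶ (X + Y)
  convergesTo-+ {x} {y} {X} {Y} (converges x→X) (converges y→Y) = converges λ ε ε>0 →
    let N₁ , close₁ = x→X (ε * ½) (half-pos ε>0)
        N₂ , close₂ = y→Y (ε * ½) (half-pos ε>0)
    in N₁ ⊔ N₂ , λ n n≥ → begin-strict
      ∣ x n + y n - (X + Y) ∣       ≡⟨ cong ∣_∣ (regroup (x n) (y n) X Y) ⟩
      ∣ (x n - X) + (y n - Y) ∣     ≤⟨ ℚₚ.∣p+q∣≤∣p∣+∣q∣ (x n - X) (y n - Y) ⟩
      ∣ x n - X ∣ + ∣ y n - Y ∣     <⟨ ℚₚ.+-mono-< (close₁ n (ℕₚ.m⊔n≤o⇒m≤o N₁ N₂ n≥))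
                                                   (close₂ n (ℕₚ.m⊔n≤o⇒n≤o N₁ N₂ n≥)) ⟩
      ε * ½ + ε * ½                 ≡⟨ halves ε ⟩
      ε                             ∎
    where
    open ℚₚ.≤-Reasoning
    regroup : ∀ x y X Y → x + y - (X + Y) ≡ (x - X) + (y - Y)
    regroup = solve 4 (λ x y X Y → x :+ y :- (X :+ Y) := (x :- X) :+ (y :- Y)) refl

  convergesTo-neg : ∀ {x X} → x ⟶ X → (λ n → - x n) ⟶ (- X)
  convergesTo-neg {x} {X} (converges x→X) = converges λ ε ε>0 →
    let N , close = x→X ε ε>0
    in N , λ n n≥N → subst (_< ε) (trans (sym (ℚₚ.∣-p∣≡∣p∣ (x n - X))) (cong ∣_∣ (negate (x n) X))) (close n n≥N)
    where
    negate : ∀ x X → - (x - X) ≡ - x - - X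
    negate = solve 2 (λ x X → :- (x :- X) := :- x :- :- X) refl

  convergesTo-sub : ∀ {x y X Y} → x ⟶ X → y ⟶ Y → (λ n → x n - y n) ⟶ (X - Y)
  convergesTo-sub x→X y→Y = convergesTo-+ x→X (convergesTo-neg y→Y)

  convergesTo-* : ∀ {x y X Y} → (∀ n → ∣ y n ∣ ≤ 1ℚ) → ∣ X ∣ ≤ 1ℚ →
    x ⟶ X → y ⟶ Y → (λ n → x n * y n) ⟶ (X * Y)
  convergesTo-* {x} {y} {X} {Y} ∣y∣≤1 ∣X∣≤1 (converges x→X) (converges y→Y) = converges λ ε ε>0 →
    let N₁ , close₁ = x→X (ε * ½) (half-pos ε>0)
        N₂ , close₂ = y→Y (ε * ½) (half-pos ε>0)
    in N₁ ⊔ N₂ , λ n n≥ → begin-strict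
      ∣ x n * y n - X * Y ∣                     ≡⟨ cong ∣_∣ (split (x n) (y n) X Y) ⟩
      ∣ (x n - X) * y n + X * (y n - Y) ∣       ≤⟨ ℚₚ.∣p+q∣≤∣p∣+∣q∣ ((x n - X) * y n) (X * (y n - Y)) ⟩
      ∣ (x n - X) * y n ∣ + ∣ X * (y n - Y) ∣   ≤⟨ ℚₚ.+-mono-≤ (left n) (right n) ⟩
      ∣ x n - X ∣ + ∣ y n - Y ∣                 <⟨ ℚₚ.+-mono-< (close₁ n (ℕₚ.m⊔n≤o⇒m≤o N₁ N₂ n≥))
                                                               (close₂ n (ℕₚ.m⊔n≤o⇒n≤o N₁ N₂ n≥)) ⟩
      ε * ½ + ε * ½                             ≡⟨ halves ε ⟩
      ε                                         ∎
    where
    open ℚₚ.≤-Reasoning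
    split : ∀ x y X Y → x * y - X * Y ≡ (x - X) * y + X * (y - Y)
    split = solve 4 (λ x y X Y → x :* y :- X :* Y := (x :- X) :* y :+ X :* (y :- Y)) refl
    left : ∀ n → ∣ (x n - X) * y n ∣ ≤ ∣ x n - X ∣
    left n = subst₂ _≤_ (sym (ℚₚ.∣p*q∣≡∣p∣*∣q∣ (x n - X) (y n))) (ℚₚ.*-identityʳ _)
      (ℚₚ.*-monoˡ-≤-nonNeg ∣ x n - X ∣ {{ℚₚ.∣-∣-nonNeg (x n - X)}} (∣y∣≤1 n))
    right : ∀ n → ∣ X * (y n - Y) ∣ ≤ ∣ y n - Y ∣
    right n = subst₂ _≤_ (sym (ℚₚ.∣p*q∣≡∣p∣*∣q∣ X (y n - Y))) (ℚₚ.*-identityˡ _)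
      (ℚₚ.*-monoʳ-≤-nonNeg ∣ y n - Y ∣ {{ℚₚ.∣-∣-nonNeg (y n - Y)}} ∣X∣≤1)

  convergesTo-scale : ∀ k {x X} → x ⟶ X → (λ n → ratio k 1 * x n) ⟶ (ratio k 1 * X)
  convergesTo-scale zero    {x} {X} x→X =
    subst ((λ n → ratio 0 1 * x n) ⟶_) (sym (ℚₚ.*-zeroˡ X))
      (convergesTo-eventually {x = λ _ → 0ℚ} 0 (λ n _ → sym (ℚₚ.*-zeroˡ (x n))) (convergesTo-const 0ℚ))
  convergesTo-scale (suc k) {x} {X} x→X =
    subst ((λ n → ratio (suc k) 1 * x n) ⟶_) (sym (one-more X))
      (convergesTo-eventually {x = λ n → x n + ratio k 1 * x n} 0 (λ n _ → sym (one-more (x n)))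
        (convergesTo-+ x→X (convergesTo-scale k x→X)))
    where
    one-more : ∀ y → ratio (suc k) 1 * y ≡ y + ratio k 1 * y
    one-more y = begin-equality
        ratio (suc k) 1 * y             ≡⟨ cong (_* y) (sym (ratio-+-same 1 k 1)) ⟩
        (1ℚ + ratio k 1) * y            ≡⟨ distrib (ratio k 1) y ⟩
        y + ratio k 1 * y               ∎
      where
      open ℚₚ.≤-Reasoning
      distrib : ∀ c y → (1ℚ + c) * y ≡ y + c * y
      distrib = solve 2 (λ c y → (con 1ℚ :+ c) :* y := y :+ c :* y) refl

  convergesTo-rate : ∀ {x L} → (∀ n → L ≤ x n) → (∀ n → x n ≤ L + ratio 1 (suc n)) → x ⟶ L
  convergesTo-rate {x} {L} above below = converges threshold
    where
    close : ∀ n → ∣ x n - L ∣ ≤ ratio 1 (suc n)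
    close n = begin
        ∣ x n - L ∣                 ≡⟨ ℚₚ.0≤p⇒∣p∣≡p (subst (_≤ x n - L) (ℚₚ.+-inverseʳ L)
                                                               (ℚₚ.+-monoˡ-≤ (- L) (above n))) ⟩
        x n - L                     ≤⟨ ℚₚ.+-monoˡ-≤ (- L) (below n) ⟩
        L + ratio 1 (suc n) - L     ≡⟨ cancel L (ratio 1 (suc n)) ⟩
        ratio 1 (suc n)             ∎
      where
      open ℚₚ.≤-Reasoning
      cancel : ∀ L B → L + B - L ≡ B
      cancel = solve 2 (λ L B → L :+ B :- L := B) refl
    -- For ε = (1 + m) / (1 + d) the threshold 1 + d works, since 1 / (1 + n) < ε once n ≥ 1 + d.
    threshold : ConvergesTo x L
    threshold (mkℚ (+ zero)   d _) ε>0 = ⊥-elim (ℤ.Positive.pos (ℚ.positive ε>0))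
    threshold (mkℚ -[1+ m ]   d _) ε>0 = ⊥-elim (ℤ.Positive.pos (ℚ.positive ε>0))
    threshold ε@(mkℚ +[1+ m ] d _) ε>0 = suc d , λ n n>d →
      ℚₚ.≤-<-trans (close n) (subst (ratio 1 (suc n) <_) (ℚₚ.↥p/↧p≡p ε)
        (ratio-mono-< 1 (suc n) (suc m) (suc d)
          (ℕₚ.≤-trans (ℕₚ.≤-reflexive (ℕₚ.+-identityʳ (suc (suc d))))
                      (ℕₚ.≤-trans (ℕ.s≤s n>d) (ℕₚ.m≤m+n (suc n) (m ℕ.* suc n))))))

module LimitLaw where

  open Paths
  open MotzkinNumbers
  open Fractions
  open Limits
  open import Data.Nat as ℕ using (ℕ; zero; suc; _∸_; _^_; _≡ᵇ_; NonZero)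
  import Data.Nat.Properties as ℕₚ
  open import Data.Nat.Combinatorics using (_C_)
  open import Data.Nat.Tactic.RingSolver using (solve-∀)
  open import Data.Rational as ℚ using (ℚ; 0ℚ; 1ℚ; ∣_∣; _+_; _*_; _-_; _≤_)
  import Data.Rational.Properties as ℚₚ
  open import Data.Rational.Solver using (module +-*-Solver)
  open import Data.Product using (proj₁; proj₂)
  open import Relation.Binary.PropositionalEquality
  open +-*-Solver

  motzkin≢0 : ∀ n → NonZero (paths 0 n)
  motzkin≢0 n = ℕ.>-nonZero (motzkin-positive n)

  private
    ∣ratio∣≤1 : ∀ x d .{{_ : NonZero d}} → x ℕ.≤ d → ∣ ratio x d ∣ ≤ 1ℚ
    ∣ratio∣≤1 x d x≤d = subst (_≤ 1ℚ) (sym (ℚₚ.0≤p⇒∣p∣≡p (ratio-nonNegative x d)))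
      (ratio-mono-≤ x d 1 1 (subst₂ ℕ._≤_ (sym (ℕₚ.*-identityʳ x)) (sym (ℕₚ.*-identityˡ d)) x≤d))

    +≡⇒-≡ : ∀ {W X Y} → W + Y ≡ X → X - Y ≡ W
    +≡⇒-≡ {W} {Y = Y} refl = solve 2 (λ W Y → W :+ Y :- Y := W) refl W Y

  motzkinRatio : ℕ → ℚ
  motzkinRatio k = ratio (paths 0 k) (paths 0 (suc k))

  motzkinRatio⟶⅓ : motzkinRatio ⟶ ratio 1 3
  motzkinRatio⟶⅓ = convergesTo-rate above below
    where
    above : ∀ k → ratio 1 3 ≤ motzkinRatio k
    above k = ratio-mono-≤ 1 3 (paths 0 k) (paths 0 (suc k)) {{d≢0 = motzkin≢0 (suc k)}}
      (subst₂ ℕ._≤_ (sym (ℕₚ.*-identityˡ _)) (ℕₚ.*-comm 3 (paths 0 k)) (proj₂ (motzkin-ratio-bounds k)))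
    below : ∀ k → motzkinRatio k ≤ ratio 1 3 + ratio 1 (suc k)
    below k = subst (motzkinRatio k ≤_) (sym (ratio-+ 1 3 1 (suc k)))
      (ratio-mono-≤ (paths 0 k) (paths 0 (suc k)) (1 ℕ.* suc k ℕ.+ 1 ℕ.* 3) (3 ℕ.* suc k)
                    {{motzkin≢0 (suc k)}} {{ℕₚ.m*n≢0 3 (suc k)}}
        (subst₂ ℕ._≤_ (swap k (paths 0 k)) (widen k (paths 0 (suc k)))
          (ℕₚ.≤-trans (proj₁ (motzkin-ratio-bounds k)) (ℕₚ.*-monoˡ-≤ (paths 0 (suc k)) (ℕₚ.n≤1+n (3 ℕ.+ k))))))
      where
      swap : ∀ k m → 3 ℕ.* ((1 ℕ.+ k) ℕ.* m) ≡ m ℕ.* (3 ℕ.* suc k)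
      swap = solve-∀
      widen : ∀ k m → (4 ℕ.+ k) ℕ.* m ≡ (1 ℕ.* suc k ℕ.+ 1 ℕ.* 3) ℕ.* m
      widen = solve-∀

  pathsQuotient : ℕ → ℕ → ℕ → ℚ
  pathsQuotient h s m = ratio (paths h m) (paths 0 (s ℕ.+ m))

  motzkinQuotient⟶ : ∀ s → pathsQuotient 0 s ⟶ ratio 1 (3 ^ s)
  motzkinQuotient⟶ zero    = convergesTo-eventually 0 (λ m _ → one m) (convergesTo-const 1ℚ)
    where
    one : ∀ m → 1ℚ ≡ pathsQuotient 0 0 m
    one m = ratio-cong 1 1 (paths 0 m) (paths 0 m) {{d≢0 = motzkin≢0 m}} (ℕₚ.*-comm 1 (paths 0 m))
  motzkinQuotient⟶ (suc s) = subst (pathsQuotient 0 (suc s) ⟶_) limit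
    (convergesTo-eventually 0 (λ m _ → telescope m)
      (convergesTo-* (λ m → ∣ratio∣≤1 _ _ {{motzkin≢0 (suc s ℕ.+ m)}} (motzkin-mono (s ℕ.+ m)))
                     (∣ratio∣≤1 1 (3 ^ s) {{3^s≢0}} (ℕₚ.m^n>0 3 s))
        (motzkinQuotient⟶ s) (convergesTo-shift s motzkinRatio⟶⅓)))
    where
    3^s≢0 = ℕₚ.m^n≢0 3 s
    telescope : ∀ m → pathsQuotient 0 s m * motzkinRatio (s ℕ.+ m) ≡ pathsQuotient 0 (suc s) m
    telescope m = trans (ratio-* (paths 0 m) Mₛ Mₛ M₁₊ₛ)
                        (ratio-cong _ _ _ _ {{ℕₚ.m*n≢0 Mₛ M₁₊ₛ}} (assoc (paths 0 m) Mₛ M₁₊ₛ))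
      where
      Mₛ = paths 0 (s ℕ.+ m)
      M₁₊ₛ = paths 0 (suc s ℕ.+ m)
      instance
        _ = motzkin≢0 (s ℕ.+ m)
        _ = motzkin≢0 (suc s ℕ.+ m)
      assoc : ∀ a b c → a ℕ.* b ℕ.* c ≡ a ℕ.* (b ℕ.* c)
      assoc = solve-∀
    limit : ratio 1 (3 ^ s) * ratio 1 3 ≡ ratio 1 (3 ^ suc s)
    limit = trans (ratio-* 1 (3 ^ s) 1 3 {{3^s≢0}})
      (ratio-cong _ _ _ _ {{ℕₚ.m*n≢0 (3 ^ s) 3 {{3^s≢0}}}} {{ℕₚ.m^n≢0 3 (suc s)}} (cong (ℕ._+ 0) (ℕₚ.*-comm 3 (3 ^ s))))

  pathsQuotient⟶ : ∀ h s → h ℕ.≤ s → pathsQuotient h s ⟶ ratio (suc h) (3 ^ s)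
  pathsQuotient⟶ zero          s       _             = motzkinQuotient⟶ s
  pathsQuotient⟶ (suc zero)    (suc s) _             = subst (pathsQuotient 1 (suc s) ⟶_) limit
    (convergesTo-eventually 0 (λ m _ → +≡⇒-≡ (split m))
      (convergesTo-sub (convergesTo-shift 1 (motzkinQuotient⟶ s)) (motzkinQuotient⟶ (suc s))))
    where
    instance
      _ = ℕₚ.m^n≢0 3 s
      _ = ℕₚ.m^n≢0 3 (suc s)
    split : ∀ m → pathsQuotient 1 (suc s) m + pathsQuotient 0 (suc s) m ≡ pathsQuotient 0 s (suc m)
    split m = trans (ratio-+-same _ _ _ {{motzkin≢0 (suc s ℕ.+ m)}})
      (cong₂ ratio (sym (paths-suc-zero m)) (cong (paths 0) (sym (ℕₚ.+-suc s m))))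
    limit : ratio 1 (3 ^ s) - ratio 1 (3 ^ suc s) ≡ ratio 2 (3 ^ suc s)
    limit = +≡⇒-≡ (trans (ratio-+-same 2 1 (3 ^ suc s))
                         (ratio-cong 3 (3 ^ suc s) 1 (3 ^ s) (sym (ℕₚ.*-identityˡ (3 ^ suc s)))))
  pathsQuotient⟶ (suc (suc h)) (suc s) (ℕ.s≤s h<s) = subst (pathsQuotient (2 ℕ.+ h) (suc s) ⟶_) limit
    (convergesTo-eventually 0 (λ m _ → +≡⇒-≡ (split m))
      (convergesTo-sub (convergesTo-shift 1 (pathsQuotient⟶ (suc h) s h<s))
                     (convergesTo-+ (pathsQuotient⟶ h (suc s) (ℕₚ.≤-trans (ℕₚ.n≤1+n h) (ℕₚ.m≤n⇒m≤1+n h<s)))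
                                    (pathsQuotient⟶ (suc h) (suc s) (ℕₚ.m≤n⇒m≤1+n h<s)))))
    where
    instance
      _ = ℕₚ.m^n≢0 3 s
      _ = ℕₚ.m^n≢0 3 (suc s)
    split : ∀ m → pathsQuotient (2 ℕ.+ h) (suc s) m + (pathsQuotient h (suc s) m + pathsQuotient (suc h) (suc s) m)
                ≡ pathsQuotient (suc h) s (suc m)
    split m = begin-equality
        ratio (paths (2 ℕ.+ h) m) Q + (ratio (paths h m) Q + ratio (paths (1 ℕ.+ h) m) Q)
      ≡⟨ cong (ratio (paths (2 ℕ.+ h) m) Q +_) (ratio-+-same _ _ _) ⟩
        ratio (paths (2 ℕ.+ h) m) Q + ratio (paths h m ℕ.+ paths (1 ℕ.+ h) m) Q
      ≡⟨ ratio-+-same _ _ _ ⟩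
        ratio (paths (2 ℕ.+ h) m ℕ.+ (paths h m ℕ.+ paths (1 ℕ.+ h) m)) Q
      ≡⟨ cong₂ ratio (trans (sym (ℕₚ.+-assoc (paths (2 ℕ.+ h) m) (paths h m) (paths (1 ℕ.+ h) m))) (sym (paths-suc-suc h m)))
                     (cong (paths 0) (sym (ℕₚ.+-suc s m))) ⟩
        ratio (paths (suc h) (suc m)) (paths 0 (s ℕ.+ suc m)) ∎
      where
      open ℚₚ.≤-Reasoning
      Q = paths 0 (suc s ℕ.+ m)
      instance
        _ = motzkin≢0 (suc s ℕ.+ m)
    limit : ratio (2 ℕ.+ h) (3 ^ s) - (ratio (1 ℕ.+ h) (3 ^ suc s) + ratio (2 ℕ.+ h) (3 ^ suc s)) ≡ ratio (3 ℕ.+ h) (3 ^ suc s)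
    limit = +≡⇒-≡ (begin-equality
        ratio (3 ℕ.+ h) P + (ratio (1 ℕ.+ h) P + ratio (2 ℕ.+ h) P)
      ≡⟨ cong (ratio (3 ℕ.+ h) P +_) (ratio-+-same _ _ _) ⟩
        ratio (3 ℕ.+ h) P + ratio ((1 ℕ.+ h) ℕ.+ (2 ℕ.+ h)) P
      ≡⟨ ratio-+-same _ _ _ ⟩
        ratio ((3 ℕ.+ h) ℕ.+ ((1 ℕ.+ h) ℕ.+ (2 ℕ.+ h))) P
      ≡⟨ ratio-cong _ _ _ _ (triple h (3 ^ s)) ⟩
        ratio (2 ℕ.+ h) (3 ^ s) ∎)
      where
      open ℚₚ.≤-Reasoning
      P = 3 ^ suc s
      triple : ∀ h t → ((3 ℕ.+ h) ℕ.+ ((1 ℕ.+ h) ℕ.+ (2 ℕ.+ h))) ℕ.* t ≡ (2 ℕ.+ h) ℕ.* (3 ℕ.* t)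
      triple = solve-∀

  π : ℕ → ℕ → ℚ
  π i j = ratio (((j ℕ.+ i) C i) ℕ.* j) (3 ^ suc (j ℕ.+ i))

  prob≡ : ∀ n i j → prob n i j ≡ ratio (pathsWith 0 i j n) (paths 0 n)
  prob≡ n i j = cong₂ ratio (count≡pathsWith n i j) (length-motzkin n)

  prob-flat⟶ : ∀ i → (λ n → prob n i 0) ⟶ π i 0
  prob-flat⟶ i = subst ((λ n → prob n i 0) ⟶_) (sym limit)
    (convergesTo-eventually (suc i) (λ n n>i → sym (vanishes n n>i)) (convergesTo-const 0ℚ))
    where
    unequal : ∀ n i → i ℕ.< n → indicator (n ≡ᵇ i) ≡ 0
    unequal (suc n) zero    _             = refl
    unequal (suc n) (suc i) (ℕ.s≤s i<n) = unequal n i i<n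
    vanishes : ∀ n → i ℕ.< n → prob n i 0 ≡ 0ℚ
    vanishes n i<n = trans (prob≡ n i 0)
      (trans (cong (λ k → ratio k (paths 0 n)) (trans (pathsWith-flat i n) (unequal n i i<n)))
             (ratio-zero (paths 0 n) {{motzkin≢0 n}}))
    limit : π i 0 ≡ 0ℚ
    limit = trans (cong (λ k → ratio k (3 ^ suc i)) (ℕₚ.*-zeroʳ (i C i)))
                  (ratio-zero (3 ^ suc i) {{ℕₚ.m^n≢0 3 (suc i)}})

  prob-arches⟶ : ∀ i j → (λ n → prob n i (suc j)) ⟶ π i (suc j)
  prob-arches⟶ i j = subst ((λ n → prob n i (suc j)) ⟶_) limit
    (convergesTo-eventually s (λ n n≥s → trans (sym (prob-shifted (n ∸ s)))
                                               (cong (λ n → prob n i (suc j)) (ℕₚ.m+[n∸m]≡n n≥s)))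
      (convergesTo-delay s (convergesTo-scale c (pathsQuotient⟶ j s j≤s))))
    where
    s = suc (suc (j ℕ.+ i))
    c = suc (j ℕ.+ i) C i
    j≤s : j ℕ.≤ s
    j≤s = ℕₚ.≤-trans (ℕₚ.m≤m+n j i) (ℕₚ.≤-trans (ℕₚ.n≤1+n _) (ℕₚ.n≤1+n _))
    instance
      _ = ℕₚ.m^n≢0 3 s
    prob-shifted : ∀ m → prob (s ℕ.+ m) i (suc j) ≡ ratio c 1 * pathsQuotient j s m
    prob-shifted m = begin-equality
        prob (s ℕ.+ m) i (suc j)
      ≡⟨ prob≡ (s ℕ.+ m) i (suc j) ⟩
        ratio (pathsWith 0 i (suc j) (s ℕ.+ m)) (paths 0 (s ℕ.+ m))
      ≡⟨ cong (λ k → ratio k (paths 0 (s ℕ.+ m)))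
              (trans (pathsWith-arches i j (s ℕ.+ m)) (cong (c ℕ.*_) (delay-+ s (paths j) m))) ⟩
        ratio (c ℕ.* paths j m) (paths 0 (s ℕ.+ m))
      ≡⟨ cong (ratio (c ℕ.* paths j m)) (sym (ℕₚ.*-identityˡ (paths 0 (s ℕ.+ m)))) ⟩
        ratio (c ℕ.* paths j m) (1 ℕ.* paths 0 (s ℕ.+ m))
      ≡⟨ ratio-* c 1 (paths j m) (paths 0 (s ℕ.+ m)) {{d≢0 = motzkin≢0 (s ℕ.+ m)}} ⟨
        ratio c 1 * pathsQuotient j s m ∎
      where open ℚₚ.≤-Reasoning
    limit : ratio c 1 * ratio (suc j) (3 ^ s) ≡ π i (suc j)
    limit = trans (ratio-* c 1 (suc j) (3 ^ s)) (cong (ratio (c ℕ.* suc j)) (ℕₚ.*-identityˡ (3 ^ s)))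

  prob⟶π : ∀ i j → (λ n → prob n i j) ⟶ π i j
  prob⟶π i zero    = prob-flat⟶ i
  prob⟶π i (suc j) = prob-arches⟶ i j

module GeneratingFunction where

  open Fractions
  open LimitLaw using (π)
  open import Data.Nat.Combinatorics using (_C_; nCk+nC[k+1]≡[n+1]C[k+1]; nCn≡1)
  open import Data.Bool using (true; false)
  open import Data.Nat as ℕ using (ℕ; zero; suc; _∸_; _^_; _≡ᵇ_)
  import Data.Nat.Properties as ℕₚ
  open import Data.Nat.Tactic.RingSolver using (solve-∀)
  open import Data.Rational as ℚ using (ℚ; 0ℚ; 1ℚ; _+_; _*_; _-_; -_)
  import Data.Rational.Properties as ℚₚ
  open import Data.Rational.Solver using (module +-*-Solver)
  open import Relation.Binary.PropositionalEquality
  open +-*-Solver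

  infix 4 _≐_

  _≐_ : Series → Series → Set
  f ≐ g = ∀ i j → f i j ≡ g i j

  sumTo-cong : ∀ n {f g} → (∀ k → f k ≡ g k) → sumTo n f ≡ sumTo n g
  sumTo-cong zero    f≗g = f≗g 0
  sumTo-cong (suc n) f≗g = cong₂ _+_ (sumTo-cong n f≗g) (f≗g (suc n))

  sumTo-zero : ∀ n {f} → (∀ k → f k ≡ 0ℚ) → sumTo n f ≡ 0ℚ
  sumTo-zero zero    f≗0 = f≗0 0
  sumTo-zero (suc n) f≗0 = cong₂ _+_ (sumTo-zero n f≗0) (f≗0 (suc n))

  sumTo-+ : ∀ n f g → sumTo n (λ k → f k + g k) ≡ sumTo n f + sumTo n g
  sumTo-+ zero    f g = refl
  sumTo-+ (suc n) f g =
    trans (cong (_+ (f (suc n) + g (suc n))) (sumTo-+ n f g)) (swap (sumTo n f) (sumTo n g) (f (suc n)) (g (suc n)))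
    where
    swap : ∀ a b c d → (a + b) + (c + d) ≡ (a + c) + (b + d)
    swap = solve 4 (λ a b c d → (a :+ b) :+ (c :+ d) := (a :+ c) :+ (b :+ d)) refl

  sumTo-head : ∀ n {f} → (∀ k → f (suc k) ≡ 0ℚ) → sumTo n f ≡ f 0
  sumTo-head zero    tail≗0 = refl
  sumTo-head (suc n) tail≗0 = trans (cong₂ _+_ (sumTo-head n tail≗0) (tail≗0 n)) (ℚₚ.+-identityʳ _)

  sumTo-suc : ∀ n f → sumTo (suc n) f ≡ f 0 + sumTo n (λ k → f (suc k))
  sumTo-suc zero    f = refl
  sumTo-suc (suc n) f = trans (cong (_+ f (2 ℕ.+ n)) (sumTo-suc n f)) (ℚₚ.+-assoc (f 0) _ _)

  ⊛-congˡ : ∀ {f f′} g → f ≐ f′ → (f ⊛ g) ≐ (f′ ⊛ g)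
  ⊛-congˡ g f≐f′ i j = sumTo-cong i (λ a → sumTo-cong j (λ b → cong (_* g (i ∸ a) (j ∸ b)) (f≐f′ a b)))

  ⊛-distribʳ-⊕ : ∀ f g h → ((f ⊕ g) ⊛ h) ≐ ((f ⊛ h) ⊕ (g ⊛ h))
  ⊛-distribʳ-⊕ f g h i j = trans
    (sumTo-cong i (λ a → trans (sumTo-cong j (λ b → ℚₚ.*-distribʳ-+ (h (i ∸ a) (j ∸ b)) (f a b) (g a b))) (sumTo-+ j _ _)))
    (sumTo-+ i _ _)

  shiftᵘ : {A : Set} → A → (ℕ → ℕ → A) → ℕ → ℕ → A
  shiftᵘ o f zero    j = o
  shiftᵘ o f (suc i) j = f i j

  shiftᵛ : {A : Set} → A → (ℕ → ℕ → A) → ℕ → ℕ → A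
  shiftᵛ o f i zero    = o
  shiftᵛ o f i (suc j) = f i j

  u·_ v·_ : Series → Series
  u· f = shiftᵘ 0ℚ f
  v· f = shiftᵛ 0ℚ f

  infixr 25 u·_ v·_

  scale : ℚ → Series → Series
  scale c f i j = c * f i j

  uᵃvᵇ· : ℕ → ℕ → Series → Series
  uᵃvᵇ· (suc a) b       f = u· uᵃvᵇ· a b f
  uᵃvᵇ· zero    (suc b) f = v· uᵃvᵇ· zero b f
  uᵃvᵇ· zero    zero    f = f

  u·-cong : ∀ {f g} → f ≐ g → u· f ≐ u· g
  u·-cong f≐g zero    j = refl
  u·-cong f≐g (suc i) j = f≐g i j

  v·-cong : ∀ {f g} → f ≐ g → v· f ≐ v· g
  v·-cong f≐g i zero    = refl
  v·-cong f≐g i (suc j) = f≐g i j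

  private
    mono-suc-u : ∀ c a b i j → mono c (suc a) b (suc i) j ≡ mono c a b i j
    mono-suc-u c a b i j with i ≡ᵇ a | j ≡ᵇ b
    ... | true  | true  = refl
    ... | true  | false = refl
    ... | false | _     = refl

    mono-suc-v : ∀ c a b i j → mono c a (suc b) i (suc j) ≡ mono c a b i j
    mono-suc-v c a b i j with i ≡ᵇ a | j ≡ᵇ b
    ... | true  | true  = refl
    ... | true  | false = refl
    ... | false | _     = refl

    mono-zero-v : ∀ c a b i → mono c a (suc b) i zero ≡ 0ℚ
    mono-zero-v c a b i with i ≡ᵇ a
    ... | true  = refl
    ... | false = refl

    0*-sum : ∀ n (f : ℕ → ℚ) → sumTo n (λ k → 0ℚ * f k) ≡ 0ℚ
    0*-sum n f = sumTo-zero n (λ k → ℚₚ.*-zeroˡ (f k))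

    mono-suc-u-⊛ : ∀ c a b g → (mono c (suc a) b ⊛ g) ≐ u· (mono c a b ⊛ g)
    mono-suc-u-⊛ c a b g zero    j = 0*-sum j (λ b′ → g 0 (j ∸ b′))
    mono-suc-u-⊛ c a b g (suc i) j = begin-equality
        sumTo (suc i) (λ a′ → sumTo j (λ b′ → mono c (suc a) b a′ b′ * g (suc i ∸ a′) (j ∸ b′)))
      ≡⟨ sumTo-suc i _ ⟩
        sumTo j (λ b′ → 0ℚ * g (suc i) (j ∸ b′))
          + sumTo i (λ a′ → sumTo j (λ b′ → mono c (suc a) b (suc a′) b′ * g (i ∸ a′) (j ∸ b′)))
      ≡⟨ cong₂ _+_ (0*-sum j (λ b′ → g (suc i) (j ∸ b′)))
                   (sumTo-cong i (λ a′ → sumTo-cong j (λ b′ → cong (_* g (i ∸ a′) (j ∸ b′)) (mono-suc-u c a b a′ b′)))) ⟩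
        0ℚ + (mono c a b ⊛ g) i j
      ≡⟨ ℚₚ.+-identityˡ _ ⟩
        (mono c a b ⊛ g) i j ∎
      where open ℚₚ.≤-Reasoning

    mono-suc-v-⊛ : ∀ c a b g → (mono c a (suc b) ⊛ g) ≐ v· (mono c a b ⊛ g)
    mono-suc-v-⊛ c a b g i zero    =
      sumTo-zero i (λ a′ → trans (cong (_* g (i ∸ a′) 0) (mono-zero-v c a b a′)) (ℚₚ.*-zeroˡ (g (i ∸ a′) 0)))
    mono-suc-v-⊛ c a b g i (suc j) = sumTo-cong i (λ a′ → begin-equality
        sumTo (suc j) (λ b′ → mono c a (suc b) a′ b′ * g (i ∸ a′) (suc j ∸ b′))
      ≡⟨ sumTo-suc j _ ⟩
        mono c a (suc b) a′ 0 * g (i ∸ a′) (suc j) + sumTo j (λ b′ → mono c a (suc b) a′ (suc b′) * g (i ∸ a′) (j ∸ b′))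
      ≡⟨ cong₂ _+_ (trans (cong (_* g (i ∸ a′) (suc j)) (mono-zero-v c a b a′)) (ℚₚ.*-zeroˡ (g (i ∸ a′) (suc j))))
                   (sumTo-cong j (λ b′ → cong (_* g (i ∸ a′) (j ∸ b′)) (mono-suc-v c a b a′ b′))) ⟩
        0ℚ + sumTo j (λ b′ → mono c a b a′ b′ * g (i ∸ a′) (j ∸ b′))
      ≡⟨ ℚₚ.+-identityˡ _ ⟩
        sumTo j (λ b′ → mono c a b a′ b′ * g (i ∸ a′) (j ∸ b′)) ∎)
      where open ℚₚ.≤-Reasoning

    mono-zero-⊛ : ∀ c g → (mono c 0 0 ⊛ g) ≐ scale c g
    mono-zero-⊛ c g i j = trans (sumTo-head i (λ a′ → 0*-sum j (λ b′ → g (i ∸ suc a′) (j ∸ b′))))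
                                (sumTo-head j (λ b′ → ℚₚ.*-zeroˡ (g i (j ∸ suc b′))))

  mono-⊛ : ∀ c a b g → (mono c a b ⊛ g) ≐ uᵃvᵇ· a b (scale c g)
  mono-⊛ c (suc a) b       g i j = trans (mono-suc-u-⊛ c a b g i j) (u·-cong (mono-⊛ c a b g) i j)
  mono-⊛ c zero    (suc b) g i j = trans (mono-suc-v-⊛ c 0 b g i j) (v·-cong (mono-⊛ c 0 b g) i j)
  mono-⊛ c zero    zero    g i j = mono-zero-⊛ c g i j

  uv3² : Series
  uv3² = mono (ratio 9 1) 0 0 ⊕ (mono (- ratio 6 1) 1 0 ⊕ (mono (- ratio 6 1) 0 1
       ⊕ (mono 1ℚ 2 0 ⊕ (mono (ratio 2 1) 1 1 ⊕ mono 1ℚ 0 2))))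

  private
    uv3-vanishesᵘ : ∀ a b → uv3 (2 ℕ.+ a) b ≡ 0ℚ
    uv3-vanishesᵘ a b = refl

    uv3-vanishesᵛ : ∀ a b → uv3 a (2 ℕ.+ b) ≡ 0ℚ
    uv3-vanishesᵛ zero          b = refl
    uv3-vanishesᵛ (suc zero)    b = refl
    uv3-vanishesᵛ (suc (suc a)) b = refl

    uv3⊛uv3-vanishesᵘ : ∀ a b → (uv3 ⊛ uv3) (3 ℕ.+ a) b ≡ 0ℚ
    uv3⊛uv3-vanishesᵘ a b = sumTo-zero (3 ℕ.+ a) (λ a′ → sumTo-zero b (λ b′ → term a′ b′))
      where
      term : ∀ a′ b′ → uv3 a′ b′ * uv3 (3 ℕ.+ a ∸ a′) (b ∸ b′) ≡ 0ℚ
      term zero          b′ = trans (cong (uv3 0 b′ *_) (uv3-vanishesᵘ (suc a) (b ∸ b′))) (ℚₚ.*-zeroʳ (uv3 0 b′))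
      term (suc zero)    b′ = trans (cong (uv3 1 b′ *_) (uv3-vanishesᵘ a (b ∸ b′))) (ℚₚ.*-zeroʳ (uv3 1 b′))
      term (suc (suc a′)) b′ = ℚₚ.*-zeroˡ (uv3 (3 ℕ.+ a ∸ suc (suc a′)) (b ∸ b′))

    uv3⊛uv3-vanishesᵛ : ∀ a b → (uv3 ⊛ uv3) a (3 ℕ.+ b) ≡ 0ℚ
    uv3⊛uv3-vanishesᵛ a b = sumTo-zero a (λ a′ → sumTo-zero (3 ℕ.+ b) (λ b′ → term a′ b′))
      where
      term : ∀ a′ b′ → uv3 a′ b′ * uv3 (a ∸ a′) (3 ℕ.+ b ∸ b′) ≡ 0ℚ
      term a′ zero          = trans (cong (uv3 a′ 0 *_) (uv3-vanishesᵛ (a ∸ a′) (suc b))) (ℚₚ.*-zeroʳ (uv3 a′ 0))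
      term a′ (suc zero)    = trans (cong (uv3 a′ 1 *_) (uv3-vanishesᵛ (a ∸ a′) b)) (ℚₚ.*-zeroʳ (uv3 a′ 1))
      term a′ (suc (suc b′)) =
        trans (cong (_* uv3 (a ∸ a′) (1 ℕ.+ b ∸ b′)) (uv3-vanishesᵛ a′ b′)) (ℚₚ.*-zeroˡ (uv3 (a ∸ a′) (1 ℕ.+ b ∸ b′)))

  uv3⊛uv3≐uv3² : uv3 ⊛ uv3 ≐ uv3²
  uv3⊛uv3≐uv3² 0                 0                 = refl
  uv3⊛uv3≐uv3² 0                 1                 = refl
  uv3⊛uv3≐uv3² 0                 2                 = refl
  uv3⊛uv3≐uv3² 1                 0                 = refl
  uv3⊛uv3≐uv3² 1                 1                 = refl
  uv3⊛uv3≐uv3² 1                 2                 = refl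
  uv3⊛uv3≐uv3² 2                 0                 = refl
  uv3⊛uv3≐uv3² 2                 1                 = refl
  uv3⊛uv3≐uv3² 2                 2                 = refl
  uv3⊛uv3≐uv3² (suc (suc (suc a))) b               = uv3⊛uv3-vanishesᵘ a b
  uv3⊛uv3≐uv3² 0                 (suc (suc (suc b))) = uv3⊛uv3-vanishesᵛ 0 b
  uv3⊛uv3≐uv3² 1                 (suc (suc (suc b))) = uv3⊛uv3-vanishesᵛ 1 b
  uv3⊛uv3≐uv3² 2                 (suc (suc (suc b))) = uv3⊛uv3-vanishesᵛ 2 b

  uv3²-⊛ : ∀ p → uv3² ⊛ p ≐ scale (ratio 9 1) p ⊕ (u· scale (- ratio 6 1) p ⊕ (v· scale (- ratio 6 1) p
                           ⊕ (u· u· scale 1ℚ p ⊕ (u· v· scale (ratio 2 1) p ⊕ v· v· scale 1ℚ p))))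
  uv3²-⊛ p =
    ⊕-⊛ m₀₀ (m₁₀ ⊕ (m₀₁ ⊕ (m₂₀ ⊕ (m₁₁ ⊕ m₀₂)))) (mono-⊛ _ 0 0 p)
    (⊕-⊛ m₁₀ (m₀₁ ⊕ (m₂₀ ⊕ (m₁₁ ⊕ m₀₂))) (mono-⊛ _ 1 0 p)
    (⊕-⊛ m₀₁ (m₂₀ ⊕ (m₁₁ ⊕ m₀₂)) (mono-⊛ _ 0 1 p)
    (⊕-⊛ m₂₀ (m₁₁ ⊕ m₀₂) (mono-⊛ _ 2 0 p)
    (⊕-⊛ m₁₁ m₀₂ (mono-⊛ _ 1 1 p) (mono-⊛ _ 0 2 p)))))
    where
    m₀₀ = mono (ratio 9 1) 0 0
    m₁₀ = mono (- ratio 6 1) 1 0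
    m₀₁ = mono (- ratio 6 1) 0 1
    m₂₀ = mono 1ℚ 2 0
    m₁₁ = mono (ratio 2 1) 1 1
    m₀₂ = mono 1ℚ 0 2
    ⊕-⊛ : ∀ f g {F G} → f ⊛ p ≐ F → g ⊛ p ≐ G → (f ⊕ g) ⊛ p ≐ F ⊕ G
    ⊕-⊛ f g f⊛p≐F g⊛p≐G i j = trans (⊛-distribʳ-⊕ f g p i j) (cong₂ _+_ (f⊛p≐F i j) (g⊛p≐G i j))

  binomial : ℕ → ℕ → ℕ
  binomial i j = (j ℕ.+ i) C i

  numerator : ℕ → ℕ → ℕ
  numerator i j = binomial i j ℕ.* j

  unit : ℕ → ℕ → ℕ
  unit zero    zero    = 1
  unit zero    (suc j) = 0
  unit (suc i) j       = 0

  binomial-pascal : ∀ i j → binomial i j ≡ shiftᵘ 0 binomial i j ℕ.+ shiftᵛ 0 binomial i j ℕ.+ unit i j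
  binomial-pascal zero    zero    = refl
  binomial-pascal zero    (suc j) = refl
  binomial-pascal (suc i) zero    = trans (nCn≡1 (suc i)) (sym (cong (λ t → t ℕ.+ 0 ℕ.+ 0) (nCn≡1 i)))
  binomial-pascal (suc i) (suc j) = sym (begin-equality
      suc (j ℕ.+ i) C i ℕ.+ (j ℕ.+ suc i) C suc i ℕ.+ 0
    ≡⟨ ℕₚ.+-identityʳ _ ⟩
      suc (j ℕ.+ i) C i ℕ.+ (j ℕ.+ suc i) C suc i
    ≡⟨ cong (λ m → m C i ℕ.+ (j ℕ.+ suc i) C suc i) (sym (ℕₚ.+-suc j i)) ⟩
      (j ℕ.+ suc i) C i ℕ.+ (j ℕ.+ suc i) C suc i
    ≡⟨ nCk+nC[k+1]≡[n+1]C[k+1] (j ℕ.+ suc i) i ⟩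
      suc (j ℕ.+ suc i) C suc i ∎)
    where open ℕₚ.≤-Reasoning

  numerator-pascal : ∀ i j → numerator i j ≡ shiftᵘ 0 numerator i j ℕ.+ shiftᵛ 0 numerator i j ℕ.+ shiftᵛ 0 binomial i j
  numerator-pascal zero    zero    = refl
  numerator-pascal (suc i) zero    =
    trans (ℕₚ.*-zeroʳ (binomial (suc i) 0)) (sym (cong (λ t → t ℕ.+ 0 ℕ.+ 0) (ℕₚ.*-zeroʳ (binomial i 0))))
  numerator-pascal zero    (suc j) = peel j
    where
    peel : ∀ j → 1 ℕ.* suc j ≡ 0 ℕ.+ 1 ℕ.* j ℕ.+ 1
    peel = solve-∀
  numerator-pascal (suc i) (suc j) = begin-equality
      binomial (suc i) (suc j) ℕ.* suc j
    ≡⟨ cong (ℕ._* suc j) (binomial-pascal (suc i) (suc j)) ⟩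
      (binomial i (suc j) ℕ.+ binomial (suc i) j ℕ.+ 0) ℕ.* suc j
    ≡⟨ expand (binomial i (suc j)) (binomial (suc i) j) j ⟩
      binomial i (suc j) ℕ.* suc j ℕ.+ binomial (suc i) j ℕ.* j ℕ.+ binomial (suc i) j ∎
    where
    open ℕₚ.≤-Reasoning
    expand : ∀ b₁ b₂ j → (b₁ ℕ.+ b₂ ℕ.+ 0) ℕ.* suc j ≡ b₁ ℕ.* suc j ℕ.+ b₂ ℕ.* j ℕ.+ b₂
    expand = solve-∀

  private
    shiftᵘ-sum : ∀ {F X Y Z : ℕ → ℕ → ℕ} → (∀ i j → F i j ≡ X i j ℕ.+ Y i j ℕ.+ Z i j) →
      ∀ i j → shiftᵘ 0 F i j ≡ shiftᵘ 0 X i j ℕ.+ shiftᵘ 0 Y i j ℕ.+ shiftᵘ 0 Z i j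
    shiftᵘ-sum F≡ zero    j = refl
    shiftᵘ-sum F≡ (suc i) j = F≡ i j

    shiftᵛ-sum : ∀ {F X Y Z : ℕ → ℕ → ℕ} → (∀ i j → F i j ≡ X i j ℕ.+ Y i j ℕ.+ Z i j) →
      ∀ i j → shiftᵛ 0 F i j ≡ shiftᵛ 0 X i j ℕ.+ shiftᵛ 0 Y i j ℕ.+ shiftᵛ 0 Z i j
    shiftᵛ-sum F≡ i zero    = refl
    shiftᵛ-sum F≡ i (suc j) = F≡ i j

    shiftᵛ-shiftᵘ : ∀ (f : ℕ → ℕ → ℕ) i j → shiftᵛ 0 (shiftᵘ 0 f) i j ≡ shiftᵘ 0 (shiftᵛ 0 f) i j
    shiftᵛ-shiftᵘ f zero    zero    = refl
    shiftᵛ-shiftᵘ f zero    (suc j) = refl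
    shiftᵛ-shiftᵘ f (suc i) zero    = refl
    shiftᵛ-shiftᵘ f (suc i) (suc j) = refl

  -- (1 − u − v)·binomial = 1 and (1 − u − v)·numerator = v·binomial, so (1 − u − v)²·numerator = v.
  numerator-identity : ∀ i j →
    let u = shiftᵘ 0 ; v = shiftᵛ 0 in
    numerator i j ℕ.+ u (u numerator) i j ℕ.+ 2 ℕ.* u (v numerator) i j ℕ.+ v (v numerator) i j
      ≡ 2 ℕ.* u numerator i j ℕ.+ 2 ℕ.* v numerator i j ℕ.+ v unit i j
  numerator-identity i j = begin-equality
      g ℕ.+ uug ℕ.+ 2 ℕ.* uvg ℕ.+ vvg
    ≡⟨ cong (λ t → t ℕ.+ uug ℕ.+ 2 ℕ.* uvg ℕ.+ vvg) (numerator-pascal i j) ⟩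
      ug ℕ.+ vg ℕ.+ vB ℕ.+ uug ℕ.+ 2 ℕ.* uvg ℕ.+ vvg
    ≡⟨ cong (λ t → ug ℕ.+ vg ℕ.+ t ℕ.+ uug ℕ.+ 2 ℕ.* uvg ℕ.+ vvg)
            (trans (shiftᵛ-sum binomial-pascal i j) (cong (λ t → t ℕ.+ vvB ℕ.+ vδ) (shiftᵛ-shiftᵘ binomial i j))) ⟩
      ug ℕ.+ vg ℕ.+ (uvB ℕ.+ vvB ℕ.+ vδ) ℕ.+ uug ℕ.+ 2 ℕ.* uvg ℕ.+ vvg
    ≡⟨ regroup ug vg uvB vvB vδ uug uvg vvg ⟩
      ug ℕ.+ vg ℕ.+ (uug ℕ.+ uvg ℕ.+ uvB) ℕ.+ (uvg ℕ.+ vvg ℕ.+ vvB) ℕ.+ vδ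
    ≡⟨ cong₂ (λ s t → ug ℕ.+ vg ℕ.+ s ℕ.+ t ℕ.+ vδ)
             (sym (shiftᵘ-sum numerator-pascal i j))
             (sym (trans (shiftᵛ-sum numerator-pascal i j) (cong (λ t → t ℕ.+ vvg ℕ.+ vvB) (shiftᵛ-shiftᵘ numerator i j)))) ⟩
      ug ℕ.+ vg ℕ.+ ug ℕ.+ vg ℕ.+ vδ
    ≡⟨ double ug vg vδ ⟩
      2 ℕ.* ug ℕ.+ 2 ℕ.* vg ℕ.+ vδ ∎
    where
    open ℕₚ.≤-Reasoning
    u = shiftᵘ 0
    v = shiftᵛ 0
    g = numerator i j
    ug = u numerator i j
    vg = v numerator i j
    uug = u (u numerator) i j
    uvg = u (v numerator) i j
    vvg = v (v numerator) i j
    vB = v binomial i j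
    uvB = u (v binomial) i j
    vvB = v (v binomial) i j
    vδ = v unit i j
    regroup : ∀ ug vg uvB vvB vδ uug uvg vvg →
      ug ℕ.+ vg ℕ.+ (uvB ℕ.+ vvB ℕ.+ vδ) ℕ.+ uug ℕ.+ 2 ℕ.* uvg ℕ.+ vvg
        ≡ ug ℕ.+ vg ℕ.+ (uug ℕ.+ uvg ℕ.+ uvB) ℕ.+ (uvg ℕ.+ vvg ℕ.+ vvB) ℕ.+ vδ
    regroup = solve-∀
    double : ∀ ug vg vδ → ug ℕ.+ vg ℕ.+ ug ℕ.+ vg ℕ.+ vδ ≡ 2 ℕ.* ug ℕ.+ 2 ℕ.* vg ℕ.+ vδ
    double = solve-∀

  fromℕ : ℕ → ℚ
  fromℕ n = ratio n 1

  fromℕ-+ : ∀ m n → fromℕ (m ℕ.+ n) ≡ fromℕ m + fromℕ n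
  fromℕ-+ m n = sym (ratio-+-same m n 1)

  fromℕ-* : ∀ m n → fromℕ (m ℕ.* n) ≡ fromℕ m * fromℕ n
  fromℕ-* m n = sym (ratio-* m 1 n 1)

  ⅓^ : ℕ → ℚ
  ⅓^ e = ratio 1 (3 ^ e)

  -- Writing every series over the common weight 3^−(i+j) turns the identity for π into one between
  -- natural-number numerators.
  record Weighted (f : Series) (n : ℕ → ℕ → ℕ) (k : ℚ) : Set where
    constructor weighted
    field weight : ∀ i j → f i j ≡ fromℕ (n i j) * (k * ⅓^ (j ℕ.+ i))

  open Weighted

  private
    3*⅓^-suc : ∀ e → fromℕ 3 * ⅓^ (suc e) ≡ ⅓^ e
    3*⅓^-suc e = trans (ratio-* 3 1 1 (3 ^ suc e)) (ratio-cong (3 ℕ.* 1) (1 ℕ.* 3 ^ suc e) 1 (3 ^ e) (cross (3 ^ e)))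
      where
      instance
        _ = ℕₚ.m^n≢0 3 e
        _ = ℕₚ.m^n≢0 3 (suc e)
        _ = ℕₚ.m*n≢0 1 (3 ^ suc e)
      cross : ∀ t → 3 ℕ.* 1 ℕ.* t ≡ 1 ℕ.* (1 ℕ.* (3 ℕ.* t))
      cross = solve-∀

    rescale : ∀ x k w → x * (k * (fromℕ 3 * w)) ≡ x * ((fromℕ 3 * k) * w)
    rescale = solve 3 (λ x k w → x :* (k :* (con (fromℕ 3) :* w)) := x :* ((con (fromℕ 3) :* k) :* w)) refl

  ratio-3^suc : ∀ x e → ratio x (3 ^ suc e) ≡ fromℕ x * (ratio 1 3 * ⅓^ e)
  ratio-3^suc x e = begin-equality
      ratio x (3 ^ suc e)                      ≡⟨ ratio-cong x (3 ^ suc e) (x ℕ.* 1) (1 ℕ.* (3 ^ suc e)) (cross x (3 ^ suc e)) ⟩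
      ratio (x ℕ.* 1) (1 ℕ.* (3 ^ suc e))      ≡⟨ ratio-* x 1 1 (3 ^ suc e) ⟨
      fromℕ x * ratio 1 (3 ^ suc e)            ≡⟨ cong (fromℕ x *_) (ratio-* 1 3 1 (3 ^ e)) ⟨
      fromℕ x * (ratio 1 3 * ⅓^ e)             ∎
    where
    open ℚₚ.≤-Reasoning
    instance
      _ = ℕₚ.m^n≢0 3 e
      _ = ℕₚ.m^n≢0 3 (suc e)
      _ = ℕₚ.m*n≢0 1 (3 ^ suc e)
    cross : ∀ x t → x ℕ.* (1 ℕ.* t) ≡ x ℕ.* 1 ℕ.* t
    cross = solve-∀

  π-weighted : Weighted π numerator (ratio 1 3)
  π-weighted = weighted λ i j → ratio-3^suc (numerator i j) (j ℕ.+ i)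

  scale-weighted : ∀ {f n k} c → Weighted f n k → Weighted (scale c f) n (c * k)
  scale-weighted {f} {n} {k} c (weighted f≈) =
    weighted λ i j → trans (cong (c *_) (f≈ i j)) (swap c (fromℕ (n i j)) k (⅓^ (j ℕ.+ i)))
    where
    swap : ∀ c x k w → c * (x * (k * w)) ≡ x * ((c * k) * w)
    swap = solve 4 (λ c x k w → c :* (x :* (k :* w)) := x :* ((c :* k) :* w)) refl

  u-weighted : ∀ {f n k} → Weighted f n k → Weighted (u· f) (shiftᵘ 0 n) (fromℕ 3 * k)
  u-weighted {f} {n} {k} (weighted f≈) = weighted shifted
    where
    shifted : ∀ i j → (u· f) i j ≡ fromℕ (shiftᵘ 0 n i j) * ((fromℕ 3 * k) * ⅓^ (j ℕ.+ i))
    shifted zero    j = sym (ℚₚ.*-zeroˡ ((fromℕ 3 * k) * ⅓^ (j ℕ.+ 0)))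
    shifted (suc i) j = begin-equality
        f i j                                                ≡⟨ f≈ i j ⟩
        fromℕ (n i j) * (k * ⅓^ (j ℕ.+ i))                   ≡⟨ cong (λ w → fromℕ (n i j) * (k * w)) (sym (3*⅓^-suc (j ℕ.+ i))) ⟩
        fromℕ (n i j) * (k * (fromℕ 3 * ⅓^ (suc (j ℕ.+ i)))) ≡⟨ rescale (fromℕ (n i j)) k (⅓^ (suc (j ℕ.+ i))) ⟩
        fromℕ (n i j) * ((fromℕ 3 * k) * ⅓^ (suc (j ℕ.+ i))) ≡⟨ cong (λ e → fromℕ (n i j) * ((fromℕ 3 * k) * ⅓^ e)) (sym (ℕₚ.+-suc j i)) ⟩
        fromℕ (n i j) * ((fromℕ 3 * k) * ⅓^ (j ℕ.+ suc i))   ∎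
      where open ℚₚ.≤-Reasoning

  v-weighted : ∀ {f n k} → Weighted f n k → Weighted (v· f) (shiftᵛ 0 n) (fromℕ 3 * k)
  v-weighted {f} {n} {k} (weighted f≈) = weighted shifted
    where
    shifted : ∀ i j → (v· f) i j ≡ fromℕ (shiftᵛ 0 n i j) * ((fromℕ 3 * k) * ⅓^ (j ℕ.+ i))
    shifted i zero    = sym (ℚₚ.*-zeroˡ ((fromℕ 3 * k) * ⅓^ i))
    shifted i (suc j) = begin-equality
        f i j                                                ≡⟨ f≈ i j ⟩
        fromℕ (n i j) * (k * ⅓^ (j ℕ.+ i))                   ≡⟨ cong (λ w → fromℕ (n i j) * (k * w)) (sym (3*⅓^-suc (j ℕ.+ i))) ⟩
        fromℕ (n i j) * (k * (fromℕ 3 * ⅓^ (suc (j ℕ.+ i)))) ≡⟨ rescale (fromℕ (n i j)) k (⅓^ (suc (j ℕ.+ i))) ⟩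
        fromℕ (n i j) * ((fromℕ 3 * k) * ⅓^ (suc j ℕ.+ i))   ∎
      where open ℚₚ.≤-Reasoning

  private
    k₉ k₆ k₁ k₂ : ℚ
    k₉ = ratio 9 1 * ratio 1 3
    k₆ = fromℕ 3 * (- ratio 6 1 * ratio 1 3)
    k₁ = fromℕ 3 * (fromℕ 3 * (1ℚ * ratio 1 3))
    k₂ = fromℕ 3 * (fromℕ 3 * (ratio 2 1 * ratio 1 3))

    collect : ∀ q a b c d e f δ → a ℕ.+ b ℕ.+ 2 ℕ.* c ℕ.+ d ≡ 2 ℕ.* e ℕ.+ 2 ℕ.* f ℕ.+ δ →
      fromℕ a * (k₉ * q) + (fromℕ e * (k₆ * q) + (fromℕ f * (k₆ * q)
        + (fromℕ b * (k₁ * q) + (fromℕ c * (k₂ * q) + fromℕ d * (k₁ * q))))) ≡ (fromℕ 3 * q) * fromℕ δ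
    collect q a b c d e f δ eq = begin-equality
        fromℕ a * (k₉ * q) + (fromℕ e * (k₆ * q) + (fromℕ f * (k₆ * q)
          + (fromℕ b * (k₁ * q) + (fromℕ c * (k₂ * q) + fromℕ d * (k₁ * q)))))
      ≡⟨ factor q (fromℕ a) (fromℕ b) (fromℕ c) (fromℕ d) (fromℕ e) (fromℕ f) ⟩
        (fromℕ 3 * q) * ((fromℕ a + fromℕ b + fromℕ 2 * fromℕ c + fromℕ d) - E)
      ≡⟨ cong (λ t → (fromℕ 3 * q) * (t - E)) (trans (sym left) (trans (cong fromℕ eq) right)) ⟩
        (fromℕ 3 * q) * ((E + fromℕ δ) - E)
      ≡⟨ cancel (fromℕ 3 * q) E (fromℕ δ) ⟩
        (fromℕ 3 * q) * fromℕ δ ∎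
      where
      open ℚₚ.≤-Reasoning
      E = fromℕ 2 * fromℕ e + fromℕ 2 * fromℕ f
      left : fromℕ (a ℕ.+ b ℕ.+ 2 ℕ.* c ℕ.+ d) ≡ fromℕ a + fromℕ b + fromℕ 2 * fromℕ c + fromℕ d
      left = trans (fromℕ-+ (a ℕ.+ b ℕ.+ 2 ℕ.* c) d)
        (cong (_+ fromℕ d) (trans (fromℕ-+ (a ℕ.+ b) (2 ℕ.* c)) (cong₂ _+_ (fromℕ-+ a b) (fromℕ-* 2 c))))
      right : fromℕ (2 ℕ.* e ℕ.+ 2 ℕ.* f ℕ.+ δ) ≡ E + fromℕ δ
      right = trans (fromℕ-+ (2 ℕ.* e ℕ.+ 2 ℕ.* f) δ)
        (cong (_+ fromℕ δ) (trans (fromℕ-+ (2 ℕ.* e) (2 ℕ.* f)) (cong₂ _+_ (fromℕ-* 2 e) (fromℕ-* 2 f))))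
      factor : ∀ q a b c d e f →
        a * (k₉ * q) + (e * (k₆ * q) + (f * (k₆ * q) + (b * (k₁ * q) + (c * (k₂ * q) + d * (k₁ * q)))))
          ≡ (fromℕ 3 * q) * ((a + b + fromℕ 2 * c + d) - (fromℕ 2 * e + fromℕ 2 * f))
      factor = solve 7 (λ q a b c d e f →
        a :* (con k₉ :* q) :+ (e :* (con k₆ :* q) :+ (f :* (con k₆ :* q) :+ (b :* (con k₁ :* q)
          :+ (c :* (con k₂ :* q) :+ d :* (con k₁ :* q)))))
        := (con (fromℕ 3) :* q) :* ((a :+ b :+ con (fromℕ 2) :* c :+ d) :- (con (fromℕ 2) :* e :+ con (fromℕ 2) :* f))) refl
      cancel : ∀ c s d → c * ((s + d) - s) ≡ c * d
      cancel = solve 3 (λ c s d → c :* ((s :+ d) :- s) := c :* d) refl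

    vS-weighted : ∀ i j → vS i j ≡ (fromℕ 3 * ⅓^ (j ℕ.+ i)) * fromℕ (shiftᵛ 0 unit i j)
    vS-weighted zero    zero          = refl
    vS-weighted zero    (suc zero)    = refl
    vS-weighted zero    (suc (suc j)) = sym (ℚₚ.*-zeroʳ (fromℕ 3 * ⅓^ (suc (suc j) ℕ.+ 0)))
    vS-weighted (suc i) zero          = sym (ℚₚ.*-zeroʳ (fromℕ 3 * ⅓^ (suc i)))
    vS-weighted (suc i) (suc j)       = sym (ℚₚ.*-zeroʳ (fromℕ 3 * ⅓^ (suc j ℕ.+ suc i)))

  uv3⊛uv3⊛π≐v : (uv3 ⊛ uv3) ⊛ π ≐ vS
  uv3⊛uv3⊛π≐v i j = begin-equality
      ((uv3 ⊛ uv3) ⊛ π) i j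
    ≡⟨ ⊛-congˡ π uv3⊛uv3≐uv3² i j ⟩
      (uv3² ⊛ π) i j
    ≡⟨ uv3²-⊛ π i j ⟩
      _
    ≡⟨ cong₂ _+_ (weight w₁ i j) (cong₂ _+_ (weight w₂ i j) (cong₂ _+_ (weight w₃ i j)
         (cong₂ _+_ (weight w₄ i j) (cong₂ _+_ (weight w₅ i j) (weight w₆ i j))))) ⟩
      _
    ≡⟨ collect (⅓^ (j ℕ.+ i)) (g i j) (u (u g) i j) (u (v g) i j) (v (v g) i j) (u g i j) (v g i j) (v unit i j)
               (numerator-identity i j) ⟩
      (fromℕ 3 * ⅓^ (j ℕ.+ i)) * fromℕ (v unit i j)
    ≡⟨ vS-weighted i j ⟨
      vS i j ∎
    where
    open ℚₚ.≤-Reasoning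
    g = numerator
    u = shiftᵘ 0
    v = shiftᵛ 0
    w₁ : Weighted (scale (ratio 9 1) π) g k₉
    w₂ : Weighted (u· scale (- ratio 6 1) π) (u g) k₆
    w₃ : Weighted (v· scale (- ratio 6 1) π) (v g) k₆
    w₄ : Weighted (u· u· scale 1ℚ π) (u (u g)) k₁
    w₅ : Weighted (u· v· scale (ratio 2 1) π) (u (v g)) k₂
    w₆ : Weighted (v· v· scale 1ℚ π) (v (v g)) k₁
    w₁ = scale-weighted (ratio 9 1) π-weighted
    w₂ = u-weighted (scale-weighted (- ratio 6 1) π-weighted)
    w₃ = v-weighted (scale-weighted (- ratio 6 1) π-weighted)
    w₄ = u-weighted (u-weighted (scale-weighted 1ℚ π-weighted))
    w₅ = u-weighted (v-weighted (scale-weighted (ratio 2 1) π-weighted))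
    w₆ = v-weighted (v-weighted (scale-weighted 1ℚ π-weighted))

open Limits using (convergence)
open LimitLaw using (π; prob⟶π)
open GeneratingFunction using (uv3⊛uv3⊛π≐v)

mainTheorem3 : Σ (ℕ → ℕ → ℚ) (λ π →
                 (∀ i j → ConvergesTo (λ n → prob n i j) (π i j))
                 × (∀ i j → ((uv3 ⊛ uv3) ⊛ π) i j ≡ vS i j))
mainTheorem3 = π , (λ i j → convergence (prob⟶π i j)) , uv3⊛uv3⊛π≐v
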